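{- Let $n\ge2$, $a_1,\ldots,a_{n-1}$ nonnegative integers, $\lambda=\sum a_i\omega_i$. There exists an injection $\Psi:\mathbf R_p\to S_n$, $E\mapsto w(E)$, such that $\mu_{x(E)}=w(E)\lambda$ for every $E\in\mathbf R_p$.
   Context: $U=\mathbb R^{\binom n2}$ with coordinates $x_{i,j}$, $1\le i<j\le n$. For a Dyck-like path $d^{i,j}=((i,i+1),\ldots,(i,j),(i+1,j),\ldots,(j-1,j))$ let $S(x,d^{i,j})=\sum_{(k,l)\in d^{i,j}}x_{k,l}$. $R$ is the set of segments $[i,j]$, integers $1\le i<j\le n$; $\mathbf R_p$ is the set of $E\subset R$ such that for any two segments in $E$ with nonempty intersection, the intersection belongs to $E$. For $E\subset R$, $x(E)$ is the unique point of $U$ with $x(E)_{i,j}=0$ if $[i,j]\notin E$ and $S(x(E),d^{i,j})=a_i+\ldots+a_{j-1}$ if $[i,j]\in E$. Let $\alpha_1,\ldots,\alpha_{n-1}$ be the simple roots and $\omega_i$ the fundamental weights of $\mathfrak{sl}_n$, $\alpha_{i,j}=\alpha_i+\ldots+\alpha_{j-1}$, $\varepsilon_i=\omega_i-\omega_{i-1}$ ($\omega_0=\omega_n=0$); $S_n$ acts on weights by $w\varepsilon_i=\varepsilon_{w(i)}$. For $x\in U$ let $\mu_x=\lambda-\sum_{i<j}x_{i,j}\alpha_{i,j}$.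
   Formalization: The space U is taken over ℚ instead of ℝ, so the points x(E) have rational coordinates. -}

module Defs where

open import Data.Bool using (Bool; true; false; if_then_else_; _∧_)
open import Data.Nat as ℕ using (ℕ; zero; suc; _∸_; _⊔_; _⊓_; _≡ᵇ_; _<ᵇ_)
open import Data.Integer using (+_)
open import Data.Rational using (ℚ; 0ℚ; 1ℚ; _+_; _-_; _*_; _/_)
open import Data.Fin using (Fin; toℕ; fromℕ<)
open import Data.Fin.Permutation using (Permutation′; _⟨$⟩ʳ_)
open import Data.Product using (_×_)
open import Relation.Nullary using (yes; no)
open import Relation.Binary.PropositionalEquality using (_≡_)

-- Conventions: all indices are 1-based natural numbers as in the paper.
-- Objects indexed by i ∈ {1,…,n} etc. are encoded as functions on ℕ; only
-- the values on the relevant range are ever used / compared.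

ℕ→ℚ : ℕ → ℚ
ℕ→ℚ k = (+ k) / 1

-- sumℚ lo hi f = Σ_{lo ≤ k < hi} f k
sumℚ : ℕ → ℕ → (ℕ → ℚ) → ℚ
sumℚ lo hi f = go lo (hi ∸ lo)
  where
  go : ℕ → ℕ → ℚ
  go s zero    = 0ℚ
  go s (suc c) = f s + go (suc s) c

-- aℕ a i = a_i for 1 ≤ i ≤ n-1 (and 0 otherwise)
aℕ : (n : ℕ) → (Fin (n ∸ 1) → ℕ) → ℕ → ℕ
aℕ n a zero = 0
aℕ n a (suc k) with k ℕ.<? n ∸ 1
... | yes p = a (fromℕ< p)
... | no _  = 0

sumA : (n : ℕ) → (Fin (n ∸ 1) → ℕ) → ℕ → ℕ → ℚ
sumA n a i j = sumℚ i j (λ k → ℕ→ℚ (aℕ n a k))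

-- Weights of sl_n, in coordinates w.r.t. the fundamental weights
-- ω₁,…,ω_{n-1}: a weight μ = Σ_k μ k · ω_k (coordinates k ∉ [1,n-1] ignored).

Weight : Set
Weight = ℕ → ℚ

_≈w[_]_ : Weight → ℕ → Weight → Set
μ ≈w[ n ] ν = ∀ k → 1 ℕ.≤ k → k ℕ.< n → μ k ≡ ν k

_+w_ : Weight → Weight → Weight
(μ +w ν) k = μ k + ν k

_-w_ : Weight → Weight → Weight
(μ -w ν) k = μ k - ν k

_·w_ : ℚ → Weight → Weight
(c ·w μ) k = c * μ k

sumW : ℕ → ℕ → (ℕ → Weight) → Weight
sumW lo hi f k = sumℚ lo hi (λ i → f i k)

-- fundamental weight ω_i (ω₀ = ω_n = 0)
ω : ℕ → ℕ → Weight
ω n i k = if (i ≡ᵇ k) ∧ (0 <ᵇ i) ∧ (i <ᵇ n) then 1ℚ else 0ℚ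

ε : ℕ → ℕ → Weight
ε n i = ω n i -w ω n (i ∸ 1)

-- simple root α_i = 2ω_i − ω_{i−1} − ω_{i+1}  (Cartan matrix of sl_n)
α : ℕ → ℕ → Weight
α n i = ((ℕ→ℚ 2 ·w ω n i) -w ω n (i ∸ 1)) -w ω n (suc i)

αij : ℕ → ℕ → ℕ → Weight
αij n i j = sumW i j (α n)

λw : (n : ℕ) → (Fin (n ∸ 1) → ℕ) → Weight
λw n a = sumW 1 n (λ i → ℕ→ℚ (aℕ n a i) ·w ω n i)

-- Action of S_n on weights: w ε_i = ε_{w(i)}

permℕ : {n : ℕ} → Permutation′ n → ℕ → ℕ
permℕ {n} w zero = 0
permℕ {n} w (suc k) with k ℕ.<? n
... | yes p = suc (toℕ (w ⟨$⟩ʳ fromℕ< p))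
... | no _  = 0

-- w μ = Σ_i μ_i · w ω_i, where w ω_i = w (ε₁ + … + ε_i) = Σ_{k ≤ i} ε_{w(k)}
act : (n : ℕ) → Permutation′ n → Weight → Weight
act n w μ = sumW 1 n (λ i → μ i ·w sumW 1 (suc i) (λ k → ε n (permℕ w k)))

_≈p_ : {n : ℕ} → Permutation′ n → Permutation′ n → Set
w ≈p w′ = ∀ k → w ⟨$⟩ʳ k ≡ w′ ⟨$⟩ʳ k

-- The space U = ℝ^{binom n 2}: points x with coordinates x i j, 1 ≤ i < j ≤ n.
-- (Rational coordinates.)

Point : Set
Point = ℕ → ℕ → ℚ

InRange : ℕ → ℕ → ℕ → Set
InRange n i j = (1 ℕ.≤ i) × (i ℕ.< j) × (j ℕ.≤ n)

S : Point → ℕ → ℕ → ℚ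
S x i j = sumℚ (suc i) (suc j) (λ l → x i l) + sumℚ (suc i) j (λ k → x k j)

μ : (n : ℕ) → (Fin (n ∸ 1) → ℕ) → Point → Weight
μ n a x = λw n a -w sumW 1 n (λ i → sumW (suc i) (suc n) (λ j → x i j ·w αij n i j))

-- Sets of segments: E i j = true iff [i,j] ∈ E (for 1 ≤ i < j ≤ n)

SegSet : Set
SegSet = ℕ → ℕ → Bool

SameSet : ℕ → SegSet → SegSet → Set
SameSet n E E′ = ∀ i j → InRange n i j → E i j ≡ E′ i j

-- E ∈ 𝐑_p: whenever [i,j],[k,l] ∈ E intersect (max(i,k) ≤ min(j,l)), the
-- intersection [max(i,k),min(j,l)] is a segment of R (so max < min) lying in E.
IsRp : ℕ → SegSet → Set
IsRp n E = ∀ i j k l → InRange n i j → InRange n k l →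
  E i j ≡ true → E k l ≡ true → (i ⊔ k) ℕ.≤ (j ⊓ l) →
  ((i ⊔ k) ℕ.< (j ⊓ l)) × (E (i ⊔ k) (j ⊓ l) ≡ true)

-- x satisfies the defining conditions of x(E)
IsXE : (n : ℕ) → (Fin (n ∸ 1) → ℕ) → SegSet → Point → Set
IsXE n a E x = ∀ i j → InRange n i j →
  (E i j ≡ false → x i j ≡ 0ℚ) × (E i j ≡ true → S x i j ≡ sumA n a i j)

-- Sweep through the segments [a,b] column by column (b = 2,…,n, and a = b−1,…,1 within a
-- column), starting from the identity and composing with the transposition (a b) whenever
-- [a,b] ∈ E; Ψ(E) is the inverse of the final permutation σ.
--
-- Put Λ p = a_p + … + a_{n−1}. For any x satisfying the equations defining x(E), induction along
-- the sweep shows that the net flow of x through m along the processed segments is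
-- Λ m − Λ(σ m), σ being the current permutation: when [k,l] ∈ E is processed, the equation
-- S(x,d^{k,l}) = a_k + … + a_{l−1} forces x_{k,l} = Λ(σ k) − Λ(σ l). At the end, the
-- ω_c-coordinate of μ_x is a_c minus the difference of the net flows at c and c+1, which is
-- Λ(σ c) − Λ(σ(c+1)), the ω_c-coordinate of Ψ(E)λ. Read as a definition, the same recurrence
-- produces x(E).
--
-- Injectivity: along the sweep every processed segment [a,b] is an inversion of σ, and every
-- inversion p < q of σ is covered by a processed segment starting at p and reaching q, or
-- ending at q and starting at or before p. Hence the permutation after processing [k,l]
-- records whether [k,l] ∈ E, and σ determines E.

module Submission where

open import Defs
open import Data.Nat using (ℕ; _≤_; _∸_)
open import Data.Fin using (Fin)
open import Data.Fin.Permutation using (Permutation′)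
open import Data.Product using (Σ-syntax; ∃; _×_)
open import Function.Bundles using (_⇔_)

open import Data.Nat using (zero; suc; _<_; _≟_; _≤?_; _<?_; _⊔_; _⊓_; _≡ᵇ_; _<ᵇ_; z≤n; s≤s)
import Data.Nat.Properties as ℕ
open import Data.Fin as Fin using (toℕ; fromℕ<)
import Data.Fin.Properties as Fin
open import Data.Fin.Permutation using (_⟨$⟩ʳ_; _⟨$⟩ˡ_; transpose; _∘ₚ_; flip; inverseˡ; inverseʳ)
import Data.Fin.Permutation as Perm
import Data.Fin.Permutation.Components as Components
open import Data.Rational using (ℚ; 0ℚ; 1ℚ; _+_; _-_; _*_)
import Data.Rational.Properties as ℚ
open import Data.Bool using (Bool; true; false; if_then_else_)
open import Data.Maybe using (Maybe; just; nothing)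
open import Data.Product using (Σ; _,_; proj₁; proj₂)
open import Data.Sum using (_⊎_; inj₁; inj₂; map₁)
open import Data.Empty using (⊥; ⊥-elim)
open import Function.Bundles using (mk⇔)
open import Relation.Binary using (tri<; tri≈; tri>)
open import Relation.Binary.PropositionalEquality
open import Relation.Nullary using (¬_; yes; no; Dec)
open import Relation.Nullary.Decidable using (dec-true; dec-false; does-⇔; _×-dec_)
open import Tactic.RingSolver using (solve-∀)
open import Tactic.RingSolver.Core.AlmostCommutativeRing using (AlmostCommutativeRing; fromCommutativeRing)

-- Finite sums

ℚ-ring : AlmostCommutativeRing _ _
ℚ-ring = fromCommutativeRing ℚ.+-*-commutativeRing isZero
  where
  isZero : (q : ℚ) → Maybe (0ℚ ≡ q)
  isZero q with q ℚ.≟ 0ℚ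
  ... | yes q≡0 = just (sym q≡0)
  ... | no _    = nothing

m∸n≡1+m∸[1+n] : ∀ {m n} → n < m → m ∸ n ≡ suc (m ∸ suc n)
m∸n≡1+m∸[1+n] {suc m} {zero}  _         = refl
m∸n≡1+m∸[1+n] {suc m} {suc n} (s≤s n<m) = m∸n≡1+m∸[1+n] n<m

sum-unfold : ∀ {lo hi} f → lo < hi → sumℚ lo hi f ≡ f lo + sumℚ (suc lo) hi f
sum-unfold f lo<hi rewrite m∸n≡1+m∸[1+n] lo<hi = refl

sum-empty : ∀ {lo hi} f → hi ≤ lo → sumℚ lo hi f ≡ 0ℚ
sum-empty f hi≤lo rewrite ℕ.m≤n⇒m∸n≡0 hi≤lo = refl

module _ (hi : ℕ) (P : ℕ → Set)
         (base : ∀ lo → hi ≤ lo → P lo)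
         (step : ∀ lo → lo < hi → P (suc lo) → P lo) where

  private
    go : ∀ d lo → hi ∸ lo ≡ d → P lo
    go zero    lo eq = base lo (ℕ.m∸n≡0⇒m≤n eq)
    go (suc d) lo eq = step lo lo<hi (go d (suc lo) (ℕ.suc-injective (trans (sym (m∸n≡1+m∸[1+n] lo<hi)) eq)))
      where
      lo<hi : lo < hi
      lo<hi = ℕ.m∸n≢0⇒n<m (λ eq′ → ℕ.0≢1+n (trans (sym eq′) eq))

  downward-induction : ∀ lo → P lo
  downward-induction lo = go (hi ∸ lo) lo refl

sum-cong : ∀ lo hi {f g : ℕ → ℚ} → (∀ i → lo ≤ i → i < hi → f i ≡ g i) → sumℚ lo hi f ≡ sumℚ lo hi g
sum-cong lo hi {f} {g} = downward-induction hi P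
  (λ lo hi≤lo _ → trans (sum-empty f hi≤lo) (sym (sum-empty g hi≤lo)))
  (λ lo lo<hi ih f≗g → begin
     sumℚ lo hi f                 ≡⟨ sum-unfold f lo<hi ⟩
     f lo + sumℚ (suc lo) hi f    ≡⟨ cong₂ _+_ (f≗g lo ℕ.≤-refl lo<hi) (ih (λ i lo<i → f≗g i (ℕ.<⇒≤ lo<i))) ⟩
     g lo + sumℚ (suc lo) hi g    ≡⟨ sum-unfold g lo<hi ⟨
     sumℚ lo hi g                 ∎)
  lo
  where
  open ≡-Reasoning
  P : ℕ → Set
  P lo = (∀ i → lo ≤ i → i < hi → f i ≡ g i) → sumℚ lo hi f ≡ sumℚ lo hi g

sum-const-0 : ∀ lo hi → sumℚ lo hi (λ _ → 0ℚ) ≡ 0ℚ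
sum-const-0 lo hi = downward-induction hi (λ lo → sumℚ lo hi (λ _ → 0ℚ) ≡ 0ℚ)
  (λ lo hi≤lo → sum-empty _ hi≤lo)
  (λ lo lo<hi ih → trans (sum-unfold _ lo<hi) (trans (ℚ.+-identityˡ _) ih))
  lo

sum-zero : ∀ lo hi {f : ℕ → ℚ} → (∀ i → lo ≤ i → i < hi → f i ≡ 0ℚ) → sumℚ lo hi f ≡ 0ℚ
sum-zero lo hi f≗0 = trans (sum-cong lo hi f≗0) (sum-const-0 lo hi)

sum-+ : ∀ lo hi (f g : ℕ → ℚ) → sumℚ lo hi (λ i → f i + g i) ≡ sumℚ lo hi f + sumℚ lo hi g
sum-+ lo hi f g = downward-induction hi P
  (λ lo hi≤lo → trans (sum-empty _ hi≤lo) (sym (cong₂ _+_ (sum-empty f hi≤lo) (sum-empty g hi≤lo))))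
  (λ lo lo<hi ih → begin
     sumℚ lo hi (λ i → f i + g i)                                ≡⟨ sum-unfold _ lo<hi ⟩
     (f lo + g lo) + sumℚ (suc lo) hi (λ i → f i + g i)          ≡⟨ cong ((f lo + g lo) +_) ih ⟩
     (f lo + g lo) + (sumℚ (suc lo) hi f + sumℚ (suc lo) hi g)   ≡⟨ interchange (f lo) (g lo) _ _ ⟩
     (f lo + sumℚ (suc lo) hi f) + (g lo + sumℚ (suc lo) hi g)   ≡⟨ cong₂ _+_ (sum-unfold f lo<hi) (sum-unfold g lo<hi) ⟨
     sumℚ lo hi f + sumℚ lo hi g                                 ∎)
  lo
  where
  open ≡-Reasoning
  P : ℕ → Set
  P lo = sumℚ lo hi (λ i → f i + g i) ≡ sumℚ lo hi f + sumℚ lo hi g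
  interchange : ∀ a b c d → (a + b) + (c + d) ≡ (a + c) + (b + d)
  interchange = solve-∀ ℚ-ring

sum-*ˡ : ∀ lo hi c (f : ℕ → ℚ) → sumℚ lo hi (λ i → c * f i) ≡ c * sumℚ lo hi f
sum-*ˡ lo hi c f = downward-induction hi P
  (λ lo hi≤lo → trans (sum-empty _ hi≤lo) (sym (trans (cong (c *_) (sum-empty f hi≤lo)) (ℚ.*-zeroʳ c))))
  (λ lo lo<hi ih → begin
     sumℚ lo hi (λ i → c * f i)                  ≡⟨ sum-unfold _ lo<hi ⟩
     c * f lo + sumℚ (suc lo) hi (λ i → c * f i)  ≡⟨ cong (c * f lo +_) ih ⟩
     c * f lo + c * sumℚ (suc lo) hi f            ≡⟨ ℚ.*-distribˡ-+ c (f lo) _ ⟨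
     c * (f lo + sumℚ (suc lo) hi f)              ≡⟨ cong (c *_) (sum-unfold f lo<hi) ⟨
     c * sumℚ lo hi f                             ∎)
  lo
  where
  open ≡-Reasoning
  P : ℕ → Set
  P lo = sumℚ lo hi (λ i → c * f i) ≡ c * sumℚ lo hi f

sum-sub : ∀ lo hi (f g : ℕ → ℚ) → sumℚ lo hi (λ i → f i - g i) ≡ sumℚ lo hi f - sumℚ lo hi g
sum-sub lo hi f g = downward-induction hi P
  (λ lo hi≤lo → trans (sum-empty _ hi≤lo) (sym (cong₂ _-_ (sum-empty f hi≤lo) (sum-empty g hi≤lo))))
  (λ lo lo<hi ih → begin
     sumℚ lo hi (λ i → f i - g i)                                ≡⟨ sum-unfold _ lo<hi ⟩
     (f lo - g lo) + sumℚ (suc lo) hi (λ i → f i - g i)          ≡⟨ cong ((f lo - g lo) +_) ih ⟩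
     (f lo - g lo) + (sumℚ (suc lo) hi f - sumℚ (suc lo) hi g)   ≡⟨ interchange (f lo) (g lo) _ _ ⟩
     (f lo + sumℚ (suc lo) hi f) - (g lo + sumℚ (suc lo) hi g)   ≡⟨ cong₂ _-_ (sum-unfold f lo<hi) (sum-unfold g lo<hi) ⟨
     sumℚ lo hi f - sumℚ lo hi g                                 ∎)
  lo
  where
  open ≡-Reasoning
  P : ℕ → Set
  P lo = sumℚ lo hi (λ i → f i - g i) ≡ sumℚ lo hi f - sumℚ lo hi g
  interchange : ∀ a b c d → (a - b) + (c - d) ≡ (a + c) - (b + d)
  interchange = solve-∀ ℚ-ring

sum-*ʳ : ∀ lo hi c (f : ℕ → ℚ) → sumℚ lo hi (λ i → f i * c) ≡ sumℚ lo hi f * c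
sum-*ʳ lo hi c f = begin
  sumℚ lo hi (λ i → f i * c)  ≡⟨ sum-cong lo hi (λ i _ _ → ℚ.*-comm (f i) c) ⟩
  sumℚ lo hi (λ i → c * f i)  ≡⟨ sum-*ˡ lo hi c f ⟩
  c * sumℚ lo hi f            ≡⟨ ℚ.*-comm c _ ⟩
  sumℚ lo hi f * c            ∎
  where open ≡-Reasoning

sum-split : ∀ lo mid hi (f : ℕ → ℚ) → lo ≤ mid → mid ≤ hi → sumℚ lo hi f ≡ sumℚ lo mid f + sumℚ mid hi f
sum-split lo mid hi f = downward-induction mid P
  (λ lo mid≤lo lo≤mid _ → begin
     sumℚ lo hi f                  ≡⟨ cong (λ m → sumℚ m hi f) (ℕ.≤-antisym lo≤mid mid≤lo) ⟩
     sumℚ mid hi f                 ≡⟨ ℚ.+-identityˡ _ ⟨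
     0ℚ + sumℚ mid hi f            ≡⟨ cong (_+ sumℚ mid hi f) (sum-empty f mid≤lo) ⟨
     sumℚ lo mid f + sumℚ mid hi f ∎)
  (λ lo lo<mid ih _ mid≤hi → begin
     sumℚ lo hi f                                 ≡⟨ sum-unfold f (ℕ.<-≤-trans lo<mid mid≤hi) ⟩
     f lo + sumℚ (suc lo) hi f                    ≡⟨ cong (f lo +_) (ih lo<mid mid≤hi) ⟩
     f lo + (sumℚ (suc lo) mid f + sumℚ mid hi f) ≡⟨ ℚ.+-assoc (f lo) _ _ ⟨
     (f lo + sumℚ (suc lo) mid f) + sumℚ mid hi f ≡⟨ cong (_+ sumℚ mid hi f) (sum-unfold f lo<mid) ⟨
     sumℚ lo mid f + sumℚ mid hi f                ∎)
  lo
  where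
  open ≡-Reasoning
  P : ℕ → Set
  P lo = lo ≤ mid → mid ≤ hi → sumℚ lo hi f ≡ sumℚ lo mid f + sumℚ mid hi f

sum-singleton : ∀ i (f : ℕ → ℚ) → sumℚ i (suc i) f ≡ f i
sum-singleton i f = trans (sum-unfold f ℕ.≤-refl) (trans (cong (f i +_) (sum-empty {suc i} f ℕ.≤-refl)) (ℚ.+-identityʳ (f i)))

sum-snoc : ∀ lo hi (f : ℕ → ℚ) → lo ≤ hi → sumℚ lo (suc hi) f ≡ sumℚ lo hi f + f hi
sum-snoc lo hi f lo≤hi = begin
  sumℚ lo (suc hi) f                   ≡⟨ sum-split lo hi (suc hi) f lo≤hi (ℕ.n≤1+n hi) ⟩
  sumℚ lo hi f + sumℚ hi (suc hi) f    ≡⟨ cong (sumℚ lo hi f +_) (sum-singleton hi f) ⟩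
  sumℚ lo hi f + f hi                  ∎
  where open ≡-Reasoning

sum-single : ∀ lo hi (f : ℕ → ℚ) p → lo ≤ p → p < hi → (∀ i → lo ≤ i → i < hi → i ≢ p → f i ≡ 0ℚ) →
  sumℚ lo hi f ≡ f p
sum-single lo hi f p lo≤p p<hi f≗0 = begin
  sumℚ lo hi f                                ≡⟨ sum-split lo p hi f lo≤p (ℕ.<⇒≤ p<hi) ⟩
  sumℚ lo p f + sumℚ p hi f                   ≡⟨ cong (sumℚ lo p f +_) (sum-unfold f p<hi) ⟩
  sumℚ lo p f + (f p + sumℚ (suc p) hi f)     ≡⟨ cong₂ (λ u v → u + (f p + v)) below above ⟩
  0ℚ + (f p + 0ℚ)                             ≡⟨ trans (ℚ.+-identityˡ _) (ℚ.+-identityʳ _) ⟩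
  f p                                         ∎
  where
  open ≡-Reasoning
  below : sumℚ lo p f ≡ 0ℚ
  below = sum-zero lo p (λ i lo≤i i<p → f≗0 i lo≤i (ℕ.<-trans i<p p<hi) (ℕ.<⇒≢ i<p))
  above : sumℚ (suc p) hi f ≡ 0ℚ
  above = sum-zero (suc p) hi (λ i p<i i<hi → f≗0 i (ℕ.≤-trans lo≤p (ℕ.<⇒≤ p<i)) i<hi (ℕ.>⇒≢ p<i))

sum-update : ∀ lo hi (f g : ℕ → ℚ) p → lo ≤ p → p < hi → (∀ i → i ≢ p → f i ≡ g i) →
  sumℚ lo hi g ≡ sumℚ lo hi f + (g p - f p)
sum-update lo hi f g p lo≤p p<hi f≗g = begin
  sumℚ lo hi g                                  ≡⟨ sum-cong lo hi (λ i _ _ → split (g i) (f i)) ⟩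
  sumℚ lo hi (λ i → f i + (g i - f i))          ≡⟨ sum-+ lo hi f (λ i → g i - f i) ⟩
  sumℚ lo hi f + sumℚ lo hi (λ i → g i - f i)   ≡⟨ cong (sumℚ lo hi f +_) (sum-single lo hi _ p lo≤p p<hi δ≗0) ⟩
  sumℚ lo hi f + (g p - f p)                    ∎
  where
  open ≡-Reasoning
  split : ∀ u v → u ≡ v + (u - v)
  split = solve-∀ ℚ-ring
  δ≗0 : ∀ i → lo ≤ i → i < hi → i ≢ p → g i - f i ≡ 0ℚ
  δ≗0 i _ _ i≢p = trans (cong (_- f i) (sym (f≗g i i≢p))) (ℚ.+-inverseʳ (f i))

-- Segment families and the sweep invariant

Segments : Set₁
Segments = ℕ → ℕ → Set

-- The consequences of E ∈ 𝐑_p used below, for the segments [a,b] ∈ E read as G a b.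
record IntersectionClosed (G : Segments) : Set where
  field
    no-abutting : ∀ {a b c} → G a b → G b c → ⊥
    intersect   : ∀ {a b c d} → G a b → G c d → a < c → c < b → b < d → G c b

data Covered (G : Segments) (p q : ℕ) : Set where
  starting-at : ∀ {b} → G p b → q ≤ b → Covered G p q
  ending-at   : ∀ {a} → G a q → a ≤ p → Covered G p q

LeftCover : Segments → ℕ → ℕ → Set
LeftCover G p q = Σ ℕ λ c → G c q × (∀ {a} → G a p → c < a)

RightCover : Segments → ℕ → ℕ → Set
RightCover G p q = Σ ℕ λ d → G p d × (∀ {b} → G q b → b < d)

covered-map : ∀ {G G′ : Segments} {p q} → (∀ {a b} → G a b → G′ a b) → Covered G p q → Covered G′ p q
covered-map f (starting-at g q≤b) = starting-at (f g) q≤b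
covered-map f (ending-at g a≤p)   = ending-at (f g) a≤p

-- s is the permutation obtained from the identity by the transpositions of the segments of G.
-- Injectivity only needs inversion-covered and inverted; the two cover conditions carry the induction.
record Invariant (G : Segments) (s : ℕ → ℕ) : Set where
  field
    inversion-covered : ∀ {p q} → p < q → s q ≤ s p → Covered G p q
    left-cover        : ∀ {p q a₀} → p < q → s q ≤ s p → G a₀ p → LeftCover G p q
    right-cover       : ∀ {p q b₀} → p < q → s q ≤ s p → G q b₀ → RightCover G p q
    inverted          : ∀ {a b} → G a b → s b < s a

invariant-empty : ∀ (G : Segments) → (∀ {a b} → ¬ G a b) → Invariant G (λ m → m)
invariant-empty G empty = record
  { inversion-covered = λ p<q q≤p → ⊥-elim (ℕ.<⇒≱ p<q q≤p)
  ; left-cover        = λ p<q q≤p _ → ⊥-elim (ℕ.<⇒≱ p<q q≤p)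
  ; right-cover       = λ p<q q≤p _ → ⊥-elim (ℕ.<⇒≱ p<q q≤p)
  ; inverted          = λ g → ⊥-elim (empty g)
  }

invariant-resp : ∀ {G G′ : Segments} {s s′ : ℕ → ℕ} →
  (∀ {a b} → G a b → G′ a b) → (∀ {a b} → G′ a b → G a b) → (∀ m → s′ m ≡ s m) →
  Invariant G s → Invariant G′ s′
invariant-resp {s = s} {s′} to from s′≗s I = record
  { inversion-covered = λ p<q h → covered-map to (inversion-covered p<q (unprime h))
  ; left-cover  = λ p<q h g → let c , gc , min = left-cover p<q (unprime h) (from g) in c , to gc , λ g′ → min (from g′)
  ; right-cover = λ p<q h g → let d , gd , max = right-cover p<q (unprime h) (from g) in d , to gd , λ g′ → max (from g′)
  ; inverted    = λ g → subst₂ _<_ (sym (s′≗s _)) (sym (s′≗s _)) (inverted (from g))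
  }
  where
  open Invariant I
  unprime : ∀ {p q} → s′ q ≤ s′ p → s q ≤ s p
  unprime = subst₂ _≤_ (s′≗s _) (s′≗s _)

data Position (k l m : ℕ) : Set where
  at-k      : m ≡ k → Position k l m
  at-l      : m ≡ l → Position k l m
  elsewhere : m ≢ k → m ≢ l → Position k l m

position : ∀ k l m → Position k l m
position k l m with m ≟ k | m ≟ l
... | yes m≡k | _       = at-k m≡k
... | no _    | yes m≡l = at-l m≡l
... | no m≢k  | no m≢l  = elsewhere m≢k m≢l

module AddSegment
  (G′ G : Segments) (s′ s : ℕ → ℕ) (k l : ℕ) (k<l : k < l)
  (old : ∀ {a b} → G′ a b → G a b)
  (new : G k l)
  (split : ∀ {a b} → G a b → G′ a b ⊎ (a ≡ k × b ≡ l))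
  (fresh : ¬ G′ k l)
  (end-≤l : ∀ {b} → G′ k b → b ≤ l)
  (k≤-start : ∀ {a} → G′ a l → k ≤ a)
  (closed : IntersectionClosed G)
  (s-k : s k ≡ s′ l) (s-l : s l ≡ s′ k) (s-other : ∀ {m} → m ≢ k → m ≢ l → s m ≡ s′ m)
  (I′ : Invariant G′ s′)
  where

  open IntersectionClosed closed
  open Invariant I′ renaming
    ( inversion-covered to inversion-covered′; left-cover to left-cover′
    ; right-cover to right-cover′; inverted to inverted′)

  old-unless-k : ∀ {a b} → G a b → a ≢ k → G′ a b
  old-unless-k g a≢k with split g
  ... | inj₁ g′          = g′
  ... | inj₂ (a≡k , _)   = ⊥-elim (a≢k a≡k)

  old-unless-l : ∀ {a b} → G a b → b ≢ l → G′ a b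
  old-unless-l g b≢l with split g
  ... | inj₁ g′          = g′
  ... | inj₂ (_ , b≡l)   = ⊥-elim (b≢l b≡l)

  kl-uncovered : ¬ Covered G′ k l
  kl-uncovered (starting-at g l≤b) = fresh (subst (G′ k) (ℕ.≤-antisym (end-≤l g) l≤b) g)
  kl-uncovered (ending-at g a≤k)   = fresh (subst (λ a → G′ a l) (ℕ.≤-antisym a≤k (k≤-start g)) g)

  into-l : ∀ {a q} → k < a → a < l → l < q → G′ a q → G′ a l
  into-l k<a a<l l<q g = old-unless-k (intersect new (old g) k<a a<l l<q) (ℕ.>⇒≢ k<a)

  from-k : ∀ {p b} → p < k → k < b → b < l → G′ p b → G′ k b
  from-k p<k k<b b<l g = old-unless-l (intersect (old g) new p<k k<b b<l) (ℕ.<⇒≢ b<l)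

  covered-from-k : ∀ {q} → l < q → s′ q ≤ s′ l → Covered G k q
  covered-from-k l<q h with inversion-covered′ l<q h
  ... | starting-at g _ = ⊥-elim (no-abutting new (old g))
  ... | ending-at {a} g a≤l with a ≤? k
  ...   | yes a≤k = ending-at (old g) a≤k
  ...   | no a≰k with ℕ.m≤n⇒m<n∨m≡n a≤l
  ...     | inj₂ refl = ⊥-elim (no-abutting new (old g))
  ...     | inj₁ a<l with left-cover′ l<q h (into-l (ℕ.≰⇒> a≰k) a<l l<q g)
  ...       | c , gc , c<starts with c ≤? k
  ...         | yes c≤k = ending-at (old gc) c≤k
  ...         | no c≰k  = ⊥-elim (ℕ.<-irrefl refl (c<starts (into-l (ℕ.≰⇒> c≰k) c<l l<q gc)))
    where c<l = ℕ.<-trans (c<starts (into-l (ℕ.≰⇒> a≰k) a<l l<q g)) a<l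

  covered-into-l : ∀ {p} → p < k → s′ k ≤ s′ p → Covered G p l
  covered-into-l p<k h with inversion-covered′ p<k h
  ... | ending-at g _ = ⊥-elim (no-abutting (old g) new)
  ... | starting-at {b} g k≤b with l ≤? b
  ...   | yes l≤b = starting-at (old g) l≤b
  ...   | no l≰b with ℕ.m≤n⇒m<n∨m≡n k≤b
  ...     | inj₂ refl = ⊥-elim (no-abutting (old g) new)
  ...     | inj₁ k<b with right-cover′ p<k h (from-k p<k k<b (ℕ.≰⇒> l≰b) g)
  ...       | d , gd , ends<d with l ≤? d
  ...         | yes l≤d = starting-at (old gd) l≤d
  ...         | no l≰d  = ⊥-elim (ℕ.<-irrefl refl (ends<d (from-k p<k k<d (ℕ.≰⇒> l≰d) gd)))
    where k<d = ℕ.<-trans k<b (ends<d (from-k p<k k<b (ℕ.≰⇒> l≰b) g))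

  covered-from-l : ∀ {q} → l < q → s′ q ≤ s′ k → Covered G l q
  covered-from-l l<q h with inversion-covered′ (ℕ.<-trans k<l l<q) h
  ... | starting-at g q≤b = ⊥-elim (ℕ.<⇒≱ (ℕ.<-≤-trans l<q q≤b) (end-≤l g))
  ... | ending-at g a≤k   = ending-at (old g) (ℕ.≤-trans a≤k (ℕ.<⇒≤ k<l))

  covered-into-k : ∀ {p} → p < k → s′ l ≤ s′ p → Covered G p k
  covered-into-k p<k h with inversion-covered′ (ℕ.<-trans p<k k<l) h
  ... | starting-at g l≤b = starting-at (old g) (ℕ.≤-trans (ℕ.<⇒≤ k<l) l≤b)
  ... | ending-at g a≤p   = ⊥-elim (ℕ.<⇒≱ (ℕ.≤-<-trans a≤p p<k) (k≤-start g))

  inversion-covered-new : ∀ {p q} → p < q → s q ≤ s p → Covered G p q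
  inversion-covered-new {p} {q} p<q h with position k l p | position k l q
  ... | at-k refl | at-k refl = ⊥-elim (ℕ.<-irrefl refl p<q)
  ... | at-k refl | at-l refl = starting-at new ℕ.≤-refl
  ... | at-k refl | elsewhere q≢k q≢l with ℕ.<-cmp q l
  ...   | tri< q<l _ _ = starting-at new (ℕ.<⇒≤ q<l)
  ...   | tri≈ _ q≡l _ = ⊥-elim (q≢l q≡l)
  ...   | tri> _ _ l<q = covered-from-k l<q (subst₂ _≤_ (s-other q≢k q≢l) s-k h)
  inversion-covered-new p<q h | at-l refl | at-k refl = ⊥-elim (ℕ.<-asym p<q k<l)
  inversion-covered-new p<q h | at-l refl | at-l refl = ⊥-elim (ℕ.<-irrefl refl p<q)
  inversion-covered-new p<q h | at-l refl | elsewhere q≢k q≢l =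
    covered-from-l p<q (subst₂ _≤_ (s-other q≢k q≢l) s-l h)
  inversion-covered-new p<q h | elsewhere p≢k p≢l | at-k refl =
    covered-into-k p<q (subst₂ _≤_ s-k (s-other p≢k p≢l) h)
  inversion-covered-new {p} p<q h | elsewhere p≢k p≢l | at-l refl with ℕ.<-cmp p k
  ... | tri< p<k _ _ = covered-into-l p<k (subst₂ _≤_ s-l (s-other p≢k p≢l) h)
  ... | tri≈ _ p≡k _ = ⊥-elim (p≢k p≡k)
  ... | tri> _ _ k<p = ending-at new (ℕ.<⇒≤ k<p)
  inversion-covered-new p<q h | elsewhere p≢k p≢l | elsewhere q≢k q≢l =
    covered-map old (inversion-covered′ p<q (subst₂ _≤_ (s-other q≢k q≢l) (s-other p≢k p≢l) h))

  inverted-old : ∀ {a b} → G′ a b → s b < s a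
  inverted-old {a} {b} g with position k l a | position k l b
  ... | at-l refl | _         = ⊥-elim (no-abutting new (old g))
  ... | _         | at-k refl = ⊥-elim (no-abutting (old g) new)
  ... | at-k refl | at-l refl = ⊥-elim (fresh g)
  ... | at-k refl | elsewhere b≢k b≢l =
    subst₂ _<_ (sym (s-other b≢k b≢l)) (sym s-k) (ℕ.≰⇒> λ h →
      let _ , gc , c<starts = left-cover′ (ℕ.≤∧≢⇒< (end-≤l g) b≢l) h g
      in ℕ.<⇒≱ (c<starts g) (k≤-start gc))
  ... | elsewhere a≢k a≢l | at-l refl =
    subst₂ _<_ (sym s-l) (sym (s-other a≢k a≢l)) (ℕ.≰⇒> λ h →
      let _ , gd , ends<d = right-cover′ (ℕ.≤∧≢⇒< (k≤-start g) (λ k≡a → a≢k (sym k≡a))) h g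
      in ℕ.<⇒≱ (ends<d g) (end-≤l gd))
  ... | elsewhere a≢k a≢l | elsewhere b≢k b≢l =
    subst₂ _<_ (sym (s-other b≢k b≢l)) (sym (s-other a≢k a≢l)) (inverted′ g)

  inverted-new : ∀ {a b} → G a b → s b < s a
  inverted-new g with split g
  ... | inj₁ g′             = inverted-old g′
  ... | inj₂ (refl , refl) =
    subst₂ _<_ (sym s-l) (sym s-k) (ℕ.≰⇒> λ h → kl-uncovered (inversion-covered′ k<l h))

  left-cover-from-l : ∀ {q} → l < q → s q ≤ s l → LeftCover G l q
  left-cover-from-l {q} l<q h with position k l q
  ... | at-k refl = ⊥-elim (ℕ.<-asym l<q k<l)
  ... | at-l refl = ⊥-elim (ℕ.<-irrefl refl l<q)
  ... | elsewhere q≢k q≢l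
    with inversion-covered′ (ℕ.<-trans k<l l<q) (subst₂ _≤_ (s-other q≢k q≢l) s-l h)
  ...   | starting-at g q≤b = ⊥-elim (ℕ.<⇒≱ (ℕ.<-≤-trans l<q q≤b) (end-≤l g))
  ...   | ending-at {a} g a≤k with ℕ.m≤n⇒m<n∨m≡n a≤k
  ...     | inj₂ refl = ⊥-elim (ℕ.<⇒≱ l<q (end-≤l g))
  ...     | inj₁ a<k  = a , old g , a<starts
    where
    a<starts : ∀ {a′} → G a′ l → a < a′
    a<starts g′ with split g′
    ... | inj₁ g″            = ℕ.<-≤-trans a<k (k≤-start g″)
    ... | inj₂ (refl , _)   = a<k

  left-cover-elsewhere : ∀ {p q a₀} → p ≢ k → p ≢ l → p < q → s q ≤ s p → G′ a₀ p → LeftCover G p q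
  left-cover-elsewhere {p} {q} p≢k p≢l p<q h g₀ with position k l q
  ... | at-k refl with inversion-covered′ (ℕ.<-trans p<q k<l) (subst₂ _≤_ s-k (s-other p≢k p≢l) h)
  ...   | starting-at g _ = ⊥-elim (no-abutting (old g₀) (old g))
  ...   | ending-at g a≤p = ⊥-elim (ℕ.<⇒≱ (ℕ.≤-<-trans a≤p p<q) (k≤-start g))
  left-cover-elsewhere {p} p≢k p≢l p<q h g₀ | at-l refl with ℕ.<-cmp p k
  ... | tri< p<k _ _ =
    let _ , gc , _ = left-cover′ p<k (subst₂ _≤_ s-l (s-other p≢k p≢l) h) g₀
    in ⊥-elim (no-abutting (old gc) new)
  ... | tri≈ _ p≡k _ = ⊥-elim (p≢k p≡k)
  ... | tri> _ _ k<p = k , new , k<starts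
    where
    kp-absent : ¬ G′ k p
    kp-absent g = ℕ.<⇒≱ (inverted′ g) (subst₂ _≤_ s-l (s-other p≢k p≢l) h)
    k<starts : ∀ {a} → G a p → k < a
    k<starts {a} g with ℕ.<-cmp a k
    ... | tri> _ _ k<a = k<a
    ... | tri≈ _ refl _ = ⊥-elim (kp-absent (old-unless-l g p≢l))
    ... | tri< a<k _ _ = ⊥-elim (kp-absent (old-unless-l (intersect g new a<k k<p p<q) p≢l))
  left-cover-elsewhere p≢k p≢l p<q h g₀ | elsewhere q≢k q≢l =
    let c , gc , c<starts = left-cover′ p<q (subst₂ _≤_ (s-other q≢k q≢l) (s-other p≢k p≢l) h) g₀
    in c , old gc , λ g → c<starts (old-unless-l g p≢l)

  left-cover-new : ∀ {p q a₀} → p < q → s q ≤ s p → G a₀ p → LeftCover G p q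
  left-cover-new {p} p<q h g₀ with position k l p
  ... | at-k refl         = ⊥-elim (no-abutting g₀ new)
  ... | at-l refl         = left-cover-from-l p<q h
  ... | elsewhere p≢k p≢l = left-cover-elsewhere p≢k p≢l p<q h (old-unless-l g₀ p≢l)

  right-cover-into-k : ∀ {p} → p < k → s k ≤ s p → RightCover G p k
  right-cover-into-k {p} p<k h with position k l p
  ... | at-k refl = ⊥-elim (ℕ.<-irrefl refl p<k)
  ... | at-l refl = ⊥-elim (ℕ.<-asym p<k k<l)
  ... | elsewhere p≢k p≢l
    with inversion-covered′ (ℕ.<-trans p<k k<l) (subst₂ _≤_ s-k (s-other p≢k p≢l) h)
  ...   | ending-at g a≤p = ⊥-elim (ℕ.<⇒≱ (ℕ.≤-<-trans a≤p p<k) (k≤-start g))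
  ...   | starting-at {b} g l≤b with ℕ.m≤n⇒m<n∨m≡n l≤b
  ...     | inj₂ refl = ⊥-elim (ℕ.<⇒≱ p<k (k≤-start g))
  ...     | inj₁ l<b  = b , old g , ends<b
    where
    ends<b : ∀ {b′} → G k b′ → b′ < b
    ends<b g′ with split g′
    ... | inj₁ g″           = ℕ.≤-<-trans (end-≤l g″) l<b
    ... | inj₂ (_ , refl)  = l<b

  right-cover-elsewhere : ∀ {p q b₀} → q ≢ k → q ≢ l → p < q → s q ≤ s p → G′ q b₀ → RightCover G p q
  right-cover-elsewhere {p} {q} q≢k q≢l p<q h g₀ with position k l p
  ... | at-l refl with inversion-covered′ (ℕ.<-trans k<l p<q) (subst₂ _≤_ (s-other q≢k q≢l) s-l h)
  ...   | starting-at g q≤b = ⊥-elim (ℕ.<⇒≱ (ℕ.<-≤-trans p<q q≤b) (end-≤l g))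
  ...   | ending-at g _     = ⊥-elim (no-abutting (old g) (old g₀))
  right-cover-elsewhere {q = q} q≢k q≢l p<q h g₀ | at-k refl with ℕ.<-cmp q l
  ... | tri> _ _ l<q =
    let _ , gd , _ = right-cover′ l<q (subst₂ _≤_ (s-other q≢k q≢l) s-k h) g₀
    in ⊥-elim (no-abutting new (old gd))
  ... | tri≈ _ q≡l _ = ⊥-elim (q≢l q≡l)
  ... | tri< q<l _ _ = l , new , ends<l
    where
    ql-absent : ¬ G′ q l
    ql-absent g = ℕ.<⇒≱ (inverted′ g) (subst₂ _≤_ (s-other q≢k q≢l) s-k h)
    ends<l : ∀ {b} → G q b → b < l
    ends<l {b} g with ℕ.<-cmp b l
    ... | tri< b<l _ _ = b<l
    ... | tri≈ _ refl _ = ⊥-elim (ql-absent (old-unless-k g q≢k))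
    ... | tri> _ _ l<b = ⊥-elim (ql-absent (old-unless-k (intersect new g p<q q<l l<b) q≢k))
  right-cover-elsewhere q≢k q≢l p<q h g₀ | elsewhere p≢k p≢l =
    let d , gd , ends<d = right-cover′ p<q (subst₂ _≤_ (s-other q≢k q≢l) (s-other p≢k p≢l) h) g₀
    in d , old gd , λ g → ends<d (old-unless-k g q≢k)

  right-cover-new : ∀ {p q b₀} → p < q → s q ≤ s p → G q b₀ → RightCover G p q
  right-cover-new {q = q} p<q h g₀ with position k l q
  ... | at-l refl         = ⊥-elim (no-abutting new g₀)
  ... | at-k refl         = right-cover-into-k p<q h
  ... | elsewhere q≢k q≢l = right-cover-elsewhere q≢k q≢l p<q h (old-unless-k g₀ q≢k)

  invariant : Invariant G s
  invariant = record
    { inversion-covered = inversion-covered-new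
    ; left-cover        = left-cover-new
    ; right-cover       = right-cover-new
    ; inverted          = inverted-new
    }

-- Permutations of {1,…,n}

swap : ℕ → ℕ → ℕ → ℕ
swap k l m with m ≟ k | m ≟ l
... | yes _ | _     = l
... | no _  | yes _ = k
... | no _  | no _  = m

swap-k : ∀ k l → swap k l k ≡ l
swap-k k l with k ≟ k
... | yes _   = refl
... | no k≢k  = ⊥-elim (k≢k refl)

swap-l : ∀ k l → k ≢ l → swap k l l ≡ k
swap-l k l k≢l with l ≟ k | l ≟ l
... | yes l≡k | _       = ⊥-elim (k≢l (sym l≡k))
... | no _    | yes _   = refl
... | no _    | no l≢l  = ⊥-elim (l≢l refl)

swap-other : ∀ k l m → m ≢ k → m ≢ l → swap k l m ≡ m
swap-other k l m m≢k m≢l with m ≟ k | m ≟ l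
... | yes m≡k | _       = ⊥-elim (m≢k m≡k)
... | no _    | yes m≡l = ⊥-elim (m≢l m≡l)
... | no _    | no _    = refl

swap-involutive : ∀ k l m → k ≢ l → swap k l (swap k l m) ≡ m
swap-involutive k l m k≢l with m ≟ k | m ≟ l
... | yes refl | _        = swap-l k l k≢l
... | no _     | yes refl = swap-k k l
... | no m≢k   | no m≢l   = swap-other k l m m≢k m≢l

module OneBased (n : ℕ) where

  index : Fin n → ℕ
  index i = suc (toℕ i)

  index-injective : ∀ {i j} → index i ≡ index j → i ≡ j
  index-injective eq = Fin.toℕ-injective (ℕ.suc-injective eq)

  at : ∀ {m} → 1 ≤ m → m ≤ n → Fin n
  at {suc m} _ m<n = fromℕ< m<n

  index-at : ∀ {m} (1≤m : 1 ≤ m) (m≤n : m ≤ n) → index (at 1≤m m≤n) ≡ m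
  index-at {suc m} _ m<n = cong suc (Fin.toℕ-fromℕ< m<n)

  -- P acting on {1,…,n}, extended by the identity; permℕ instead sends 0 and m > n to 0.
  ⟪_⟫ : Permutation′ n → ℕ → ℕ
  ⟪ P ⟫ zero = zero
  ⟪ P ⟫ (suc m) with m <? n
  ... | yes m<n = index (P ⟨$⟩ʳ fromℕ< m<n)
  ... | no _    = suc m

  ⟪⟫-index : ∀ P i → ⟪ P ⟫ (index i) ≡ index (P ⟨$⟩ʳ i)
  ⟪⟫-index P i with toℕ i <? n
  ... | yes i<n = cong (λ j → index (P ⟨$⟩ʳ j)) (Fin.fromℕ<-toℕ i i<n)
  ... | no i≮n  = ⊥-elim (i≮n (Fin.toℕ<n i))

  ⟪⟫-above : ∀ P m → n < m → ⟪ P ⟫ m ≡ m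
  ⟪⟫-above P (suc m) (s≤s n≤m) with m <? n
  ... | yes m<n = ⊥-elim (ℕ.<⇒≱ m<n n≤m)
  ... | no _    = refl

  ⟪⟫-id : ∀ m → ⟪ Perm.id ⟫ m ≡ m
  ⟪⟫-id zero = refl
  ⟪⟫-id (suc m) with m <? n
  ... | yes m<n = cong suc (Fin.toℕ-fromℕ< m<n)
  ... | no _    = refl

  data Range (m : ℕ) : Set where
    below  : m ≡ 0 → Range m
    inside : (i : Fin n) → m ≡ index i → Range m
    above  : n < m → Range m

  range : ∀ m → Range m
  range zero = below refl
  range (suc m) with m <? n
  ... | yes m<n = inside (fromℕ< m<n) (cong suc (sym (Fin.toℕ-fromℕ< m<n)))
  ... | no m≮n  = above (s≤s (ℕ.≮⇒≥ m≮n))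

  ⟪⟫-range : ∀ P m → 1 ≤ m → m ≤ n → 1 ≤ ⟪ P ⟫ m × ⟪ P ⟫ m ≤ n
  ⟪⟫-range P m 1≤m m≤n rewrite sym (index-at 1≤m m≤n) | ⟪⟫-index P (at 1≤m m≤n) =
    s≤s z≤n , Fin.toℕ<n _

  swap-index : ∀ x y i → swap (index x) (index y) (index i) ≡ index (Components.transpose x y i)
  swap-index x y i with i Fin.≟ x
  ... | yes refl = swap-k (index i) (index y)
  ... | no i≢x with i Fin.≟ y
  ...   | yes refl = swap-l (index x) (index i) (λ eq → i≢x (sym (index-injective eq)))
  ...   | no i≢y   =
    swap-other (index x) (index y) (index i) (λ eq → i≢x (index-injective eq)) (λ eq → i≢y (index-injective eq))

  ⟪⟫-transpose : ∀ P x y m → ⟪ transpose x y ∘ₚ P ⟫ m ≡ ⟪ P ⟫ (swap (index x) (index y) m)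
  ⟪⟫-transpose P x y m with range m
  ... | below refl = sym (cong ⟪ P ⟫ (swap-other (index x) (index y) 0 (λ ()) (λ ())))
  ... | inside i refl = begin
    ⟪ transpose x y ∘ₚ P ⟫ (index i)                 ≡⟨ ⟪⟫-index (transpose x y ∘ₚ P) i ⟩
    index (P ⟨$⟩ʳ (Components.transpose x y i))      ≡⟨ ⟪⟫-index P _ ⟨
    ⟪ P ⟫ (index (Components.transpose x y i))       ≡⟨ cong ⟪ P ⟫ (swap-index x y i) ⟨
    ⟪ P ⟫ (swap (index x) (index y) (index i))       ∎
    where open ≡-Reasoning
  ... | above n<m = begin
    ⟪ transpose x y ∘ₚ P ⟫ m                ≡⟨ ⟪⟫-above _ m n<m ⟩
    m                                       ≡⟨ ⟪⟫-above P m n<m ⟨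
    ⟪ P ⟫ m                                 ≡⟨ cong ⟪ P ⟫ (swap-other _ _ m (outside x) (outside y)) ⟨
    ⟪ P ⟫ (swap (index x) (index y) m)      ∎
    where
    open ≡-Reasoning
    outside : ∀ z → m ≢ index z
    outside z refl = ℕ.<⇒≱ n<m (Fin.toℕ<n z)

  permℕ≡⟪⟫ : ∀ P {m} → 1 ≤ m → m ≤ n → permℕ P m ≡ ⟪ P ⟫ m
  permℕ≡⟪⟫ P {suc m} _ m<n with m <? n
  ... | yes _   = refl
  ... | no m≮n  = ⊥-elim (m≮n m<n)

  ⟪flip⟫-index : ∀ P i j → ⟪ flip P ⟫ (index i) ≡ index j ⇔ index i ≡ ⟪ P ⟫ (index j)
  ⟪flip⟫-index P i j rewrite ⟪⟫-index (flip P) i | ⟪⟫-index P j = mk⇔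
    (λ eq → cong index (trans (sym (inverseʳ P)) (cong (P ⟨$⟩ʳ_) (index-injective eq))))
    (λ eq → cong index (trans (cong (P ⟨$⟩ˡ_) (index-injective eq)) (inverseˡ P)))

  ⟪flip⟫ : ∀ P {m v} → 1 ≤ m → m ≤ n → 1 ≤ v → v ≤ n → ⟪ flip P ⟫ m ≡ v ⇔ m ≡ ⟪ P ⟫ v
  ⟪flip⟫ P 1≤m m≤n 1≤v v≤n =
    subst₂ (λ m v → ⟪ flip P ⟫ m ≡ v ⇔ m ≡ ⟪ P ⟫ v) (index-at 1≤m m≤n) (index-at 1≤v v≤n) (⟪flip⟫-index P _ _)

  flip-cong : ∀ {P P′ : Permutation′ n} → (∀ i → P ⟨$⟩ʳ i ≡ P′ ⟨$⟩ʳ i) → ∀ i → P ⟨$⟩ˡ i ≡ P′ ⟨$⟩ˡ i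
  flip-cong {P} {P′} P≗P′ i = begin
    P ⟨$⟩ˡ i                         ≡⟨ cong (P ⟨$⟩ˡ_) (inverseʳ P′) ⟨
    P ⟨$⟩ˡ (P′ ⟨$⟩ʳ (P′ ⟨$⟩ˡ i))     ≡⟨ cong (P ⟨$⟩ˡ_) (P≗P′ _) ⟨
    P ⟨$⟩ˡ (P ⟨$⟩ʳ (P′ ⟨$⟩ˡ i))      ≡⟨ inverseˡ P ⟩
    P′ ⟨$⟩ˡ i                        ∎
    where open ≡-Reasoning

  ⟪⟫-cong : ∀ {P P′ : Permutation′ n} → (∀ i → P ⟨$⟩ʳ i ≡ P′ ⟨$⟩ʳ i) → ∀ m → ⟪ P ⟫ m ≡ ⟪ P′ ⟫ m
  ⟪⟫-cong {P} {P′} P≗P′ m with range m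
  ... | below refl    = refl
  ... | inside i refl = trans (⟪⟫-index P i) (trans (cong index (P≗P′ i)) (sym (⟪⟫-index P′ i)))
  ... | above n<m     = trans (⟪⟫-above P m n<m) (sym (⟪⟫-above P′ m n<m))

-- The sweep

-- In state (j , c) of the sweep, all segments [a,b] with b ≤ j and the c segments
-- [j,j+1], …, [j−c+1,j+1] have been processed; the next one is [j−c,j+1].
data Processed (j c a b : ℕ) : Set where
  earlier-column : b ≤ j → Processed j c a b
  this-column    : b ≡ suc j → j ∸ c < a → Processed j c a b

module _ {j c : ℕ} (c<j : c < j) where

  processed-suc⁺ : ∀ {a b} → Processed j c a b → Processed j (suc c) a b
  processed-suc⁺ (earlier-column b≤j)     = earlier-column b≤j
  processed-suc⁺ {a} (this-column b≡1+j lt) = this-column b≡1+j (subst (_≤ a) (m∸n≡1+m∸[1+n] c<j) (ℕ.<⇒≤ lt))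

  processed-suc⁻ : ∀ {a b} → Processed j (suc c) a b → Processed j c a b ⊎ (a ≡ j ∸ c × b ≡ suc j)
  processed-suc⁻ (earlier-column b≤j) = inj₁ (earlier-column b≤j)
  processed-suc⁻ {a} (this-column b≡1+j lt) with ℕ.<-cmp (j ∸ c) a
  ... | tri< j∸c<a _ _ = inj₁ (this-column b≡1+j j∸c<a)
  ... | tri≈ _ j∸c≡a _ = inj₂ (sym j∸c≡a , b≡1+j)
  ... | tri> _ _ a<j∸c = ⊥-elim (ℕ.<⇒≱ lt (ℕ.≤-pred (subst (suc a ≤_) (m∸n≡1+m∸[1+n] c<j) a<j∸c)))

  processed-current : Processed j (suc c) (j ∸ c) (suc j)
  processed-current = this-column refl (subst (j ∸ suc c <_) (sym (m∸n≡1+m∸[1+n] c<j)) ℕ.≤-refl)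

unprocessed-current : ∀ j c → ¬ Processed j c (j ∸ c) (suc j)
unprocessed-current j c (earlier-column 1+j≤j)   = ℕ.<-irrefl refl 1+j≤j
unprocessed-current j c (this-column _ j∸c<j∸c) = ℕ.<-irrefl refl j∸c<j∸c

processed-end-≤ : ∀ {j c b} → Processed j c (j ∸ c) b → b ≤ suc j
processed-end-≤ (earlier-column b≤j)  = ℕ.m≤n⇒m≤1+n b≤j
processed-end-≤ (this-column refl _) = ℕ.≤-refl

processed-start-≥ : ∀ {j c a} → Processed j c a (suc j) → j ∸ c ≤ a
processed-start-≥ (earlier-column 1+j≤j) = ⊥-elim (ℕ.<-irrefl refl 1+j≤j)
processed-start-≥ (this-column _ lt)     = ℕ.<⇒≤ lt

processed-next-column : ∀ {j a b} → 1 ≤ a → a < b →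
  (Processed (suc j) 0 a b → Processed j j a b) × (Processed j j a b → Processed (suc j) 0 a b)
processed-next-column {j} {a} {b} 1≤a a<b = to , from
  where
  to : Processed (suc j) 0 a b → Processed j j a b
  to (earlier-column b≤1+j) with ℕ.m≤n⇒m<n∨m≡n b≤1+j
  ... | inj₁ b<1+j = earlier-column (ℕ.≤-pred b<1+j)
  ... | inj₂ b≡1+j = this-column b≡1+j (subst (_< a) (sym (ℕ.n∸n≡0 j)) 1≤a)
  to (this-column refl 1+j<a) = ⊥-elim (ℕ.<⇒≱ 1+j<a (ℕ.≤-pred a<b))
  from : Processed j j a b → Processed (suc j) 0 a b
  from (earlier-column b≤j) = earlier-column (ℕ.m≤n⇒m≤1+n b≤j)
  from (this-column refl _) = earlier-column ℕ.≤-refl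

unprocessed-initial : ∀ {a b} → 1 ≤ a → a < b → ¬ Processed 0 0 a b
unprocessed-initial 1≤a a<b (earlier-column b≤0) = ℕ.<⇒≱ (ℕ.<-≤-trans 1≤a (ℕ.<⇒≤ a<b)) b≤0
unprocessed-initial 1≤a a<b (this-column refl _)  = ℕ.<⇒≱ a<b 1≤a

processed-final : ∀ {j a b} → 1 ≤ a → a < b → b ≤ suc j → Processed j j a b
processed-final {j} {a} 1≤a _ b≤1+j with ℕ.m≤n⇒m<n∨m≡n b≤1+j
... | inj₁ b<1+j = earlier-column (ℕ.≤-pred b<1+j)
... | inj₂ b≡1+j = this-column b≡1+j (subst (_< a) (sym (ℕ.n∸n≡0 j)) 1≤a)

1≤j∸c : ∀ {j c} → c < j → 1 ≤ j ∸ c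
1≤j∸c = ℕ.m<n⇒0<n∸m

j∸c<1+j : ∀ j c → j ∸ c < suc j
j∸c<1+j j c = s≤s (ℕ.m∸n≤m j c)

processed-shrink : ∀ {j c a a′ b} → Processed j c a b → a < a′ → Processed j c a′ b
processed-shrink (earlier-column b≤j)   _    = earlier-column b≤j
processed-shrink (this-column b≡1+j lt) a<a′ = this-column b≡1+j (ℕ.<-trans lt a<a′)

processed? : ∀ j c a b → Dec (Processed j c a b)
processed? j c a b with b ≤? j | b ≟ suc j | j ∸ c <? a
... | yes b≤j | _       | _      = yes (earlier-column b≤j)
... | no _    | yes b≡  | yes lt = yes (this-column b≡ lt)
... | no b≰j  | no b≢   | _      = no λ { (earlier-column b≤j) → b≰j b≤j ; (this-column b≡ _) → b≢ b≡ }
... | no b≰j  | _       | no ≮   = no λ { (earlier-column b≤j) → b≰j b≤j ; (this-column _ lt) → ≮ lt }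

module _ {n E} (rp : IsRp n E) where

  rp-no-abutting : ∀ {a b c} → InRange n a b → InRange n b c → E a b ≡ true → E b c ≡ true → ⊥
  rp-no-abutting {a} {b} {c} rab@(_ , a<b , _) rbc@(_ , b<c , _) ab∈E bc∈E =
    ℕ.<-irrefl refl (subst₂ _<_ a⊔b≡b b⊓c≡b (proj₁ (rp a b b c rab rbc ab∈E bc∈E meet)))
    where
    a⊔b≡b = ℕ.m≤n⇒m⊔n≡n (ℕ.<⇒≤ a<b)
    b⊓c≡b = ℕ.m≤n⇒m⊓n≡m (ℕ.<⇒≤ b<c)
    meet : a ⊔ b ≤ b ⊓ c
    meet = subst₂ _≤_ (sym a⊔b≡b) (sym b⊓c≡b) ℕ.≤-refl

  rp-intersect : ∀ {a b c d} → InRange n a b → InRange n c d → E a b ≡ true → E c d ≡ true →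
    a < c → c < b → b < d → E c b ≡ true
  rp-intersect {a} {b} {c} {d} rab rcd ab∈E cd∈E a<c c<b b<d =
    subst₂ (λ u v → E u v ≡ true) a⊔c≡c b⊓d≡b (proj₂ (rp a b c d rab rcd ab∈E cd∈E meet))
    where
    a⊔c≡c = ℕ.m≤n⇒m⊔n≡n (ℕ.<⇒≤ a<c)
    b⊓d≡b = ℕ.m≤n⇒m⊓n≡m (ℕ.<⇒≤ b<d)
    meet : a ⊔ c ≤ b ⊓ d
    meet = subst₂ _≤_ (sym a⊔c≡c) (sym b⊓d≡b) (ℕ.<⇒≤ c<b)

state-induction : ∀ {n} (Q : ℕ → ℕ → Set) → Q 0 0 →
  (∀ {j c} → c < j → suc j ≤ n → Q j c → Q j (suc c)) →
  (∀ {j} → suc (suc j) ≤ n → Q j j → Q (suc j) 0) →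
  ∀ {j c} → c ≤ j → suc j ≤ n → Q j c
state-induction {n} Q initial next-segment next-column = in-column
  where
  at-column-start : ∀ j → suc j ≤ n → Q j 0
  in-column : ∀ {j c} → c ≤ j → suc j ≤ n → Q j c
  at-column-start zero    _     = initial
  at-column-start (suc j) 2+j≤n = next-column 2+j≤n (in-column ℕ.≤-refl (ℕ.≤-trans (ℕ.n≤1+n _) 2+j≤n))
  in-column {j} {zero}  _     1+j≤n = at-column-start j 1+j≤n
  in-column {j} {suc c} 1+c≤j 1+j≤n = next-segment 1+c≤j 1+j≤n (in-column (ℕ.<⇒≤ 1+c≤j) 1+j≤n)

module Sweep (n : ℕ) where
  open OneBased n public

  InRange? : ∀ i j → Dec (InRange n i j)
  InRange? i j = (1 ≤? i) ×-dec ((i <? j) ×-dec (j ≤? n))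

  transposition : ∀ {i j} → InRange n i j → Permutation′ n
  transposition (1≤i , i<j , j≤n) =
    transpose (at 1≤i (ℕ.≤-trans (ℕ.<⇒≤ i<j) j≤n)) (at (ℕ.≤-trans 1≤i (ℕ.<⇒≤ i<j)) j≤n)

  ⟪transposition⟫ : ∀ {i j} (r : InRange n i j) P m → ⟪ transposition r ∘ₚ P ⟫ m ≡ ⟪ P ⟫ (swap i j m)
  ⟪transposition⟫ (1≤i , i<j , j≤n) P m =
    trans (⟪⟫-transpose P _ _ m) (cong₂ (λ x y → ⟪ P ⟫ (swap x y m)) (index-at _ _) (index-at _ _))

  step : SegSet → ℕ → ℕ → Permutation′ n → Permutation′ n
  step E i j P with InRange? i j
  ... | no _  = P
  ... | yes r = if E i j then transposition r ∘ₚ P else P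

  ⟪step⟫-∈ : ∀ E {i j} P → InRange n i j → E i j ≡ true → ∀ m → ⟪ step E i j P ⟫ m ≡ ⟪ P ⟫ (swap i j m)
  ⟪step⟫-∈ E {i} {j} P r i∈E m with InRange? i j
  ... | no ¬r = ⊥-elim (¬r r)
  ... | yes r′ rewrite i∈E = ⟪transposition⟫ r′ P m

  step-∉ : ∀ E {i j} P → E i j ≡ false → step E i j P ≡ P
  step-∉ E {i} {j} P i∉E with InRange? i j
  ... | no _ = refl
  ... | yes _ rewrite i∉E = refl

  column : SegSet → ℕ → ℕ → Permutation′ n → Permutation′ n
  column E j zero    P = P
  column E j (suc c) P = step E (j ∸ c) (suc j) (column E j c P)

  sweep : SegSet → ℕ → Permutation′ n
  sweep E zero    = Perm.id
  sweep E (suc j) = column E j j (sweep E j)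

  σ : SegSet → ℕ → ℕ → ℕ → ℕ
  σ E j c = ⟪ column E j c (sweep E j) ⟫

  σ-∈ : ∀ E {j c} → c < j → suc j ≤ n → E (j ∸ c) (suc j) ≡ true →
    ∀ m → σ E j (suc c) m ≡ σ E j c (swap (j ∸ c) (suc j) m)
  σ-∈ E {j} {c} c<j 1+j≤n ∈E = ⟪step⟫-∈ E _ (1≤j∸c c<j , j∸c<1+j j c , 1+j≤n) ∈E

  σ-∉ : ∀ E {j c} → E (j ∸ c) (suc j) ≡ false → ∀ m → σ E j (suc c) m ≡ σ E j c m
  σ-∉ E {j} {c} ∉E m = cong (λ P → ⟪ P ⟫ m) (step-∉ E _ ∉E)

  step-cong : ∀ {E E′ i j} {P P′ : Permutation′ n} → (∀ y → P ⟨$⟩ʳ y ≡ P′ ⟨$⟩ʳ y) →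
    (InRange n i j → E i j ≡ E′ i j) → ∀ y → step E i j P ⟨$⟩ʳ y ≡ step E′ i j P′ ⟨$⟩ʳ y
  step-cong {E} {E′} {i} {j} P≗P′ same y with InRange? i j
  ... | no _ = P≗P′ y
  ... | yes r with E i j | E′ i j | same r
  ...   | true  | true  | refl = P≗P′ _
  ...   | false | false | refl = P≗P′ y

  sweep-cong : ∀ {E E′} → SameSet n E E′ → ∀ j y → sweep E j ⟨$⟩ʳ y ≡ sweep E′ j ⟨$⟩ʳ y
  sweep-cong same zero y = refl
  sweep-cong {E} {E′} same (suc j) = column-cong j
    where
    column-cong : ∀ c y → column E j c (sweep E j) ⟨$⟩ʳ y ≡ column E′ j c (sweep E′ j) ⟨$⟩ʳ y
    column-cong zero    = sweep-cong same j
    column-cong (suc c) = step-cong {E} {E′} {j ∸ c} {suc j} (column-cong c) (same _ _)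

  ProcessedIn : SegSet → ℕ → ℕ → Segments
  ProcessedIn E j c a b = InRange n a b × E a b ≡ true × Processed j c a b

  processedIn-closed : ∀ {E j c} → IsRp n E → IntersectionClosed (ProcessedIn E j c)
  processedIn-closed rp = record
    { no-abutting = λ (rab , ab∈E , _) (rbc , bc∈E , _) → rp-no-abutting rp rab rbc ab∈E bc∈E
    ; intersect   = λ (rab@(1≤a , _ , b≤n) , ab∈E , ab-done) (rcd , cd∈E , _) a<c c<b b<d →
        (ℕ.≤-trans 1≤a (ℕ.<⇒≤ a<c) , c<b , b≤n) , rp-intersect rp rab rcd ab∈E cd∈E a<c c<b b<d ,
        processed-shrink ab-done a<c
    }

  state-invariant : ∀ {E} → IsRp n E → ∀ {j c} → c ≤ j → suc j ≤ n →
    Invariant (ProcessedIn E j c) (σ E j c)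
  state-invariant {E} rp = state-induction (λ j c → Invariant (ProcessedIn E j c) (σ E j c))
    initial next-segment next-column
    where
    initial : Invariant (ProcessedIn E 0 0) (σ E 0 0)
    initial = invariant-resp (λ g → g) (λ g → g) ⟪⟫-id
      (invariant-empty _ λ ((1≤a , a<b , _) , _ , done) → unprocessed-initial 1≤a a<b done)

    next-column : ∀ {j} → suc (suc j) ≤ n → Invariant (ProcessedIn E j j) (σ E j j) →
      Invariant (ProcessedIn E (suc j) 0) (σ E (suc j) 0)
    next-column _ = invariant-resp
      (λ (r@(1≤a , a<b , _) , ∈E , done) → r , ∈E , proj₂ (processed-next-column 1≤a a<b) done)
      (λ (r@(1≤a , a<b , _) , ∈E , done) → r , ∈E , proj₁ (processed-next-column 1≤a a<b) done)
      (λ _ → refl)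

    next-segment : ∀ {j c} → c < j → suc j ≤ n → Invariant (ProcessedIn E j c) (σ E j c) →
      Invariant (ProcessedIn E j (suc c)) (σ E j (suc c))
    next-segment {j} {c} c<j 1+j≤n I with E (j ∸ c) (suc j) in kl∈E
    ... | false = invariant-resp
      (λ (r , ∈E , done) → r , ∈E , processed-suc⁺ c<j done)
      (λ (r , ∈E , done) → r , ∈E , unchanged ∈E (processed-suc⁻ c<j done))
      (σ-∉ E {j} {c} kl∈E) I
      where
      unchanged : ∀ {a b} → E a b ≡ true → Processed j c a b ⊎ (a ≡ j ∸ c × b ≡ suc j) → Processed j c a b
      unchanged _   (inj₁ done)        = done
      unchanged ∈E (inj₂ (refl , refl)) with () ← trans (sym ∈E) kl∈E
    ... | true = AddSegment.invariant
      (ProcessedIn E j c) (ProcessedIn E j (suc c)) (σ E j c) (σ E j (suc c)) k l k<l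
      (λ (r , ∈E , done) → r , ∈E , processed-suc⁺ c<j done)
      (kl-range , kl∈E , processed-current c<j)
      (λ (r , ∈E , done) → map₁ (λ done′ → r , ∈E , done′) (processed-suc⁻ c<j done))
      (λ (_ , _ , done) → unprocessed-current j c done)
      (λ (_ , _ , done) → processed-end-≤ done)
      (λ (_ , _ , done) → processed-start-≥ done)
      (processedIn-closed rp)
      (trans (σ-∈ E {j} {c} c<j 1+j≤n kl∈E k) (cong (σ E j c) (swap-k k l)))
      (trans (σ-∈ E {j} {c} c<j 1+j≤n kl∈E l) (cong (σ E j c) (swap-l k l (ℕ.<⇒≢ k<l))))
      (λ {m} m≢k m≢l → trans (σ-∈ E {j} {c} c<j 1+j≤n kl∈E m) (cong (σ E j c) (swap-other k l m m≢k m≢l)))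
      I
      where
      k = j ∸ c
      l = suc j
      k<l : k < l
      k<l = j∸c<1+j j c
      kl-range : InRange n k l
      kl-range = 1≤j∸c c<j , k<l , 1+j≤n

  current-uncovered : ∀ E j c → ¬ Covered (ProcessedIn E j c) (j ∸ c) (suc j)
  current-uncovered E j c (starting-at (_ , _ , done) 1+j≤b) =
    unprocessed-current j c (subst (Processed j c (j ∸ c)) (ℕ.≤-antisym (processed-end-≤ done) 1+j≤b) done)
  current-uncovered E j c (ending-at (_ , _ , done) a≤j∸c) =
    unprocessed-current j c (subst (λ a → Processed j c a (suc j)) (ℕ.≤-antisym a≤j∸c (processed-start-≥ done)) done)

  σ-detects-current : ∀ {E E′ j c} → IsRp n E → IsRp n E′ → c < j → suc j ≤ n →
    E (j ∸ c) (suc j) ≡ true → E′ (j ∸ c) (suc j) ≡ false →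
    ¬ (∀ m → σ E j (suc c) m ≡ σ E′ j (suc c) m)
  σ-detects-current {E} {E′} {j} {c} rp rp′ c<j 1+j≤n ∈E ∉E′ σ≗σ′ =
    current-uncovered E′ j c (Invariant.inversion-covered I′ (j∸c<1+j j c) inversion′)
    where
    I′ = state-invariant rp′ (ℕ.<⇒≤ c<j) 1+j≤n
    inversion : σ E j (suc c) (suc j) < σ E j (suc c) (j ∸ c)
    inversion = Invariant.inverted (state-invariant rp c<j 1+j≤n)
      ((1≤j∸c c<j , j∸c<1+j j c , 1+j≤n) , ∈E , processed-current c<j)
    inversion′ : σ E′ j c (suc j) ≤ σ E′ j c (j ∸ c)
    inversion′ = ℕ.<⇒≤ (subst₂ _<_ (unstep (suc j)) (unstep (j ∸ c)) inversion)
      where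
      unstep : ∀ m → σ E j (suc c) m ≡ σ E′ j c m
      unstep m = trans (σ≗σ′ m) (σ-∉ E′ {j} {c} ∉E′ m)

  module _ {E E′} (rp : IsRp n E) (rp′ : IsRp n E′) {j c} (c<j : c < j) (1+j≤n : suc j ≤ n)
           (σ≗σ′ : ∀ m → σ E j (suc c) m ≡ σ E′ j (suc c) m) where

    current-agrees : E (j ∸ c) (suc j) ≡ E′ (j ∸ c) (suc j)
    current-agrees with E (j ∸ c) (suc j) in ∈E | E′ (j ∸ c) (suc j) in ∈E′
    ... | true  | true  = refl
    ... | false | false = refl
    ... | true  | false = ⊥-elim (σ-detects-current rp rp′ c<j 1+j≤n ∈E ∈E′ σ≗σ′)
    ... | false | true  = ⊥-elim (σ-detects-current rp′ rp c<j 1+j≤n ∈E′ ∈E (λ m → sym (σ≗σ′ m)))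

    previous-σ-agree : ∀ m → σ E j c m ≡ σ E′ j c m
    previous-σ-agree m with E (j ∸ c) (suc j) in ∈E | E′ (j ∸ c) (suc j) in ∈E′ | current-agrees
    ... | false | false | _ = begin
      σ E j c m          ≡⟨ σ-∉ E {j} {c} ∈E m ⟨
      σ E j (suc c) m    ≡⟨ σ≗σ′ m ⟩
      σ E′ j (suc c) m   ≡⟨ σ-∉ E′ {j} {c} ∈E′ m ⟩
      σ E′ j c m         ∎
      where open ≡-Reasoning
    ... | true | true | _ = begin
      σ E j c m                          ≡⟨ cong (σ E j c) (swap-involutive k l m k≢l) ⟨
      σ E j c (swap k l (swap k l m))    ≡⟨ σ-∈ E {j} {c} c<j 1+j≤n ∈E (swap k l m) ⟨
      σ E j (suc c) (swap k l m)         ≡⟨ σ≗σ′ (swap k l m) ⟩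
      σ E′ j (suc c) (swap k l m)        ≡⟨ σ-∈ E′ {j} {c} c<j 1+j≤n ∈E′ (swap k l m) ⟩
      σ E′ j c (swap k l (swap k l m))   ≡⟨ cong (σ E′ j c) (swap-involutive k l m k≢l) ⟩
      σ E′ j c m                         ∎
      where
      open ≡-Reasoning
      k = j ∸ c
      l = suc j
      k≢l = ℕ.<⇒≢ (j∸c<1+j j c)

  σ-determines-processed : ∀ {E E′} → IsRp n E → IsRp n E′ → ∀ {j c} → c ≤ j → suc j ≤ n →
    (∀ m → σ E j c m ≡ σ E′ j c m) → ∀ {a b} → InRange n a b → Processed j c a b → E a b ≡ E′ a b
  σ-determines-processed {E} {E′} rp rp′ = state-induction Agree initial next-segment next-column
    where
    Agree : ℕ → ℕ → Set
    Agree j c = (∀ m → σ E j c m ≡ σ E′ j c m) → ∀ {a b} → InRange n a b → Processed j c a b → E a b ≡ E′ a b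
    initial : Agree 0 0
    initial _ (1≤a , a<b , _) done = ⊥-elim (unprocessed-initial 1≤a a<b done)
    next-column : ∀ {j} → suc (suc j) ≤ n → Agree j j → Agree (suc j) 0
    next-column _ ih σ≗σ′ r@(1≤a , a<b , _) done = ih σ≗σ′ r (proj₁ (processed-next-column 1≤a a<b) done)
    next-segment : ∀ {j c} → c < j → suc j ≤ n → Agree j c → Agree j (suc c)
    next-segment c<j 1+j≤n ih σ≗σ′ r done with processed-suc⁻ c<j done
    ... | inj₁ done′          = ih (previous-σ-agree rp rp′ c<j 1+j≤n σ≗σ′) r done′
    ... | inj₂ (refl , refl) = current-agrees rp rp′ c<j 1+j≤n σ≗σ′

-- Weights in ω-coordinates

𝟙 : Bool → ℚ
𝟙 true  = 1ℚ
𝟙 false = 0ℚ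

sum-𝟙-in : ∀ lo hi (g : ℕ → ℚ) p → lo ≤ p → p < hi → sumℚ lo hi (λ i → g i * 𝟙 (i ≡ᵇ p)) ≡ g p
sum-𝟙-in lo hi g p lo≤p p<hi = begin
  sumℚ lo hi (λ i → g i * 𝟙 (i ≡ᵇ p))  ≡⟨ sum-single lo hi _ p lo≤p p<hi off-p ⟩
  g p * 𝟙 (p ≡ᵇ p)                     ≡⟨ cong (λ b → g p * 𝟙 b) (dec-true (p ≟ p) refl) ⟩
  g p * 1ℚ                             ≡⟨ ℚ.*-identityʳ (g p) ⟩
  g p                                  ∎
  where
  open ≡-Reasoning
  off-p : ∀ i → lo ≤ i → i < hi → i ≢ p → g i * 𝟙 (i ≡ᵇ p) ≡ 0ℚ
  off-p i _ _ i≢p = trans (cong (λ b → g i * 𝟙 b) (dec-false (i ≟ p) i≢p)) (ℚ.*-zeroʳ (g i))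

sum-𝟙-out : ∀ lo hi (g : ℕ → ℚ) p → p < lo ⊎ hi ≤ p → sumℚ lo hi (λ i → g i * 𝟙 (i ≡ᵇ p)) ≡ 0ℚ
sum-𝟙-out lo hi g p outside = sum-zero lo hi λ i lo≤i i<hi →
  trans (cong (λ b → g i * 𝟙 b) (dec-false (i ≟ p) (i≢p lo≤i i<hi outside))) (ℚ.*-zeroʳ (g i))
  where
  i≢p : ∀ {i} → lo ≤ i → i < hi → p < lo ⊎ hi ≤ p → i ≢ p
  i≢p lo≤i _    (inj₁ p<lo) refl = ℕ.<⇒≱ p<lo lo≤i
  i≢p _    i<hi (inj₂ hi≤p) refl = ℕ.<⇒≱ i<hi hi≤p

module Coordinates (n : ℕ) {c : ℕ} (1≤c : 1 ≤ c) (c<n : c < n) where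

  ω-coord : ∀ i → ω n i c ≡ 𝟙 (i ≡ᵇ c)
  ω-coord i with i ≟ c
  ... | no i≢c   rewrite dec-false (i ≟ c) i≢c = refl
  ... | yes refl rewrite dec-true (i ≟ i) refl | dec-true (0 <? i) 1≤c | dec-true (i <? n) c<n = refl

  ε-coord : ∀ m → 1 ≤ m → ε n m c ≡ 𝟙 (m ≡ᵇ c) - 𝟙 (m ≡ᵇ suc c)
  ε-coord (suc m) _ = cong₂ _-_ (ω-coord (suc m)) (ω-coord m)

  -- α_m = ε_m − ε_{m+1}, so α_{i,j} = ε_i − ε_j.
  αij-coord : ∀ i j → i ≤ j → αij n i j c ≡ ε n i c - ε n j c
  αij-coord i j = downward-induction j (λ i → i ≤ j → αij n i j c ≡ ε n i c - ε n j c)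
    (λ i j≤i i≤j → begin
       sumℚ i j (λ m → α n m c)   ≡⟨ sum-empty _ j≤i ⟩
       0ℚ                         ≡⟨ ℚ.+-inverseʳ (ε n j c) ⟨
       ε n j c - ε n j c          ≡⟨ cong (λ m → ε n m c - ε n j c) (ℕ.≤-antisym j≤i i≤j) ⟩
       ε n i c - ε n j c          ∎)
    (λ i i<j ih _ → begin
       sumℚ i j (λ m → α n m c)                                ≡⟨ sum-unfold _ i<j ⟩
       α n i c + sumℚ (suc i) j (λ m → α n m c)                ≡⟨ cong (α n i c +_) (ih i<j) ⟩
       α n i c + (ε n (suc i) c - ε n j c)                     ≡⟨ telescope (ω n i c) (ω n (i ∸ 1) c) (ω n (suc i) c) (ε n j c) ⟩
       ε n i c - ε n j c                                       ∎)
    i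
    where
    open ≡-Reasoning
    telescope : ∀ u v w z → ((((1ℚ + 1ℚ) * u) - v) - w) + ((w - u) - z) ≡ (u - v) - z
    telescope = solve-∀ ℚ-ring

  λ-coord : ∀ a → λw n a c ≡ ℕ→ℚ (aℕ n a c)
  λ-coord a = trans (sum-cong 1 n λ i _ _ → cong (ℕ→ℚ (aℕ n a i) *_) (ω-coord i))
                    (sum-𝟙-in 1 n (λ i → ℕ→ℚ (aℕ n a i)) c 1≤c c<n)

count-𝟙 : ∀ {p} i → 1 ≤ p → sumℚ 1 (suc i) (λ k → 𝟙 (k ≡ᵇ p)) ≡ 𝟙 (p <ᵇ suc i)
count-𝟙 {p} i 1≤p = trans (sum-cong 1 (suc i) λ k _ _ → sym (ℚ.*-identityˡ (𝟙 (k ≡ᵇ p)))) by-cases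
  where
  by-cases : sumℚ 1 (suc i) (λ k → 1ℚ * 𝟙 (k ≡ᵇ p)) ≡ 𝟙 (p <ᵇ suc i)
  by-cases with p <? suc i
  ... | yes p≤i = trans (sum-𝟙-in 1 (suc i) (λ _ → 1ℚ) p 1≤p p≤i) (cong 𝟙 (sym (dec-true (p <? suc i) p≤i)))
  ... | no p≰i  = trans (sum-𝟙-out 1 (suc i) (λ _ → 1ℚ) p (inj₂ (ℕ.≮⇒≥ p≰i))) (cong 𝟙 (sym (dec-false (p <? suc i) p≰i)))

module Tail (n : ℕ) (a : Fin (n ∸ 1) → ℕ) where

  aᵢ : ℕ → ℚ
  aᵢ i = ℕ→ℚ (aℕ n a i)

  Λ : ℕ → ℚ
  Λ p = sumℚ p n aᵢ

  sumA≡Λ-Λ : ∀ {k l} → k ≤ l → l ≤ n → sumA n a k l ≡ Λ k - Λ l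
  sumA≡Λ-Λ {k} {l} k≤l l≤n = trans (add-sub (sumA n a k l) (Λ l)) (cong (_- Λ l) (sym (sum-split k l n _ k≤l l≤n)))
    where
    add-sub : ∀ u v → u ≡ (u + v) - v
    add-sub = solve-∀ ℚ-ring

  aᵢ≡Λ-Λ : ∀ {c} → c < n → aᵢ c ≡ Λ c - Λ (suc c)
  aᵢ≡Λ-Λ {c} c<n = trans (sym (sum-singleton c aᵢ)) (sumA≡Λ-Λ (ℕ.n≤1+n c) c<n)

  Λ-as-sum : ∀ {p} → 1 ≤ p → p ≤ n → sumℚ 1 n (λ i → aᵢ i * 𝟙 (p <ᵇ suc i)) ≡ Λ p
  Λ-as-sum {p} 1≤p p≤n = begin
    sumℚ 1 n f                 ≡⟨ sum-split 1 p n f 1≤p p≤n ⟩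
    sumℚ 1 p f + sumℚ p n f    ≡⟨ cong₂ _+_ below above ⟩
    0ℚ + Λ p                   ≡⟨ ℚ.+-identityˡ (Λ p) ⟩
    Λ p                        ∎
    where
    open ≡-Reasoning
    f = λ i → aᵢ i * 𝟙 (p <ᵇ suc i)
    below = sum-zero 1 p λ i _ i<p →
      trans (cong (λ b → aᵢ i * 𝟙 b) (dec-false (p <? suc i) (λ p≤i → ℕ.<⇒≱ i<p (ℕ.≤-pred p≤i)))) (ℚ.*-zeroʳ (aᵢ i))
    above = sum-cong p n λ i p≤i _ →
      trans (cong (λ b → aᵢ i * 𝟙 b) (dec-true (p <? suc i) (s≤s p≤i))) (ℚ.*-identityʳ (aᵢ i))

divergence : ℕ → Point → ℕ → ℚ
divergence n x m = sumℚ (suc m) (suc n) (x m) - sumℚ 1 m (λ i → x i m)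

module MuCoordinate (n : ℕ) (a : Fin (n ∸ 1) → ℕ) (x : Point) {c : ℕ} (1≤c : 1 ≤ c) (c<n : c < n) where
  open Coordinates n 1≤c c<n
  open Tail n a

  private
    out : ℕ → ℚ
    out m = sumℚ (suc m) (suc n) (x m)
    inc : ℕ → ℚ
    inc m = sumℚ 1 m (λ i → x i m)
    into : ℕ → ℕ → ℚ
    into p i = sumℚ (suc i) (suc n) (λ j → x i j * 𝟙 (j ≡ᵇ p))

  row : ∀ i → 1 ≤ i → sumℚ (suc i) (suc n) (λ j → x i j * αij n i j c) ≡
    (out i * 𝟙 (i ≡ᵇ c) - out i * 𝟙 (i ≡ᵇ suc c)) - (into c i - into (suc c) i)
  row i 1≤i = begin
    sumℚ (suc i) (suc n) (λ j → x i j * αij n i j c)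
      ≡⟨ sum-cong (suc i) (suc n) term ⟩
    sumℚ (suc i) (suc n) (λ j → (x i j * e - x i j * e′) - (x i j * 𝟙 (j ≡ᵇ c) - x i j * 𝟙 (j ≡ᵇ suc c)))
      ≡⟨ sum-sub (suc i) (suc n) _ _ ⟩
    sumℚ (suc i) (suc n) (λ j → x i j * e - x i j * e′) -
    sumℚ (suc i) (suc n) (λ j → x i j * 𝟙 (j ≡ᵇ c) - x i j * 𝟙 (j ≡ᵇ suc c))
      ≡⟨ cong₂ _-_ (sum-sub (suc i) (suc n) _ _) (sum-sub (suc i) (suc n) _ _) ⟩
    (sumℚ (suc i) (suc n) (λ j → x i j * e) - sumℚ (suc i) (suc n) (λ j → x i j * e′)) - (into c i - into (suc c) i)
      ≡⟨ cong (_- (into c i - into (suc c) i)) (cong₂ _-_ (sum-*ʳ (suc i) (suc n) e (x i)) (sum-*ʳ (suc i) (suc n) e′ (x i))) ⟩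
    (out i * e - out i * e′) - (into c i - into (suc c) i)
      ∎
    where
    open ≡-Reasoning
    e  = 𝟙 (i ≡ᵇ c)
    e′ = 𝟙 (i ≡ᵇ suc c)
    distribute : ∀ y u v w z → y * ((u - v) - (w - z)) ≡ (y * u - y * v) - (y * w - y * z)
    distribute = solve-∀ ℚ-ring
    term : ∀ j → suc i ≤ j → j < suc n →
      x i j * αij n i j c ≡ (x i j * e - x i j * e′) - (x i j * 𝟙 (j ≡ᵇ c) - x i j * 𝟙 (j ≡ᵇ suc c))
    term j i<j _ = begin
      x i j * αij n i j c                                       ≡⟨ cong (x i j *_) (αij-coord i j (ℕ.<⇒≤ i<j)) ⟩
      x i j * (ε n i c - ε n j c)                               ≡⟨ cong (λ z → x i j * z) (cong₂ _-_ (ε-coord i 1≤i) (ε-coord j 1≤j)) ⟩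
      x i j * ((e - e′) - (𝟙 (j ≡ᵇ c) - 𝟙 (j ≡ᵇ suc c)))        ≡⟨ distribute (x i j) _ _ _ _ ⟩
      (x i j * e - x i j * e′) - (x i j * 𝟙 (j ≡ᵇ c) - x i j * 𝟙 (j ≡ᵇ suc c)) ∎
      where 1≤j = ℕ.≤-trans 1≤i (ℕ.<⇒≤ i<j)

  outgoing : ∀ p → 1 ≤ p → p ≤ n → sumℚ 1 n (λ i → out i * 𝟙 (i ≡ᵇ p)) ≡ out p
  outgoing p 1≤p p≤n with ℕ.m≤n⇒m<n∨m≡n p≤n
  ... | inj₁ p<n  = sum-𝟙-in 1 n out p 1≤p p<n
  ... | inj₂ refl = trans (sum-𝟙-out 1 n out p (inj₂ ℕ.≤-refl)) (sym (sum-empty {suc n} (x n) ℕ.≤-refl))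

  incoming : ∀ p → 1 ≤ p → p ≤ n → sumℚ 1 n (into p) ≡ inc p
  incoming p 1≤p p≤n = begin
    sumℚ 1 n (into p)                  ≡⟨ sum-split 1 p n _ 1≤p p≤n ⟩
    sumℚ 1 p (into p) + sumℚ p n (into p) ≡⟨ cong₂ _+_ before after ⟩
    inc p + 0ℚ                         ≡⟨ ℚ.+-identityʳ (inc p) ⟩
    inc p                              ∎
    where
    open ≡-Reasoning
    before = sum-cong 1 p λ i _ i<p → sum-𝟙-in (suc i) (suc n) (x i) p i<p (s≤s p≤n)
    after  = sum-zero p n λ i p≤i _ → sum-𝟙-out (suc i) (suc n) (x i) p (inj₁ (s≤s p≤i))

  μ-coord : μ n a x c ≡ aᵢ c - (divergence n x c - divergence n x (suc c))
  μ-coord = begin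
    λw n a c - sumℚ 1 n (λ i → sumℚ (suc i) (suc n) (λ j → x i j * αij n i j c))
      ≡⟨ cong₂ _-_ (λ-coord a) (sum-cong 1 n λ i 1≤i _ → row i 1≤i) ⟩
    aᵢ c - sumℚ 1 n (λ i → (out i * 𝟙 (i ≡ᵇ c) - out i * 𝟙 (i ≡ᵇ suc c)) - (into c i - into (suc c) i))
      ≡⟨ cong (λ z → aᵢ c - z) (trans (sum-sub 1 n _ _) (cong₂ _-_ (sum-sub 1 n _ _) (sum-sub 1 n _ _))) ⟩
    aᵢ c - ((sumℚ 1 n (λ i → out i * 𝟙 (i ≡ᵇ c)) - sumℚ 1 n (λ i → out i * 𝟙 (i ≡ᵇ suc c))) - (sumℚ 1 n (into c) - sumℚ 1 n (into (suc c))))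
      ≡⟨ cong (λ z → aᵢ c - z) (cong₂ _-_ (cong₂ _-_ (outgoing c 1≤c (ℕ.<⇒≤ c<n)) (outgoing (suc c) (s≤s z≤n) c<n))
                                     (cong₂ _-_ (incoming c 1≤c (ℕ.<⇒≤ c<n)) (incoming (suc c) (s≤s z≤n) c<n))) ⟩
    aᵢ c - ((out c - out (suc c)) - (inc c - inc (suc c)))
      ≡⟨ regroup (aᵢ c) (out c) (out (suc c)) (inc c) (inc (suc c)) ⟩
    aᵢ c - (divergence n x c - divergence n x (suc c))   ∎
    where
    open ≡-Reasoning
    regroup : ∀ y o₁ o₂ i₁ i₂ → y - ((o₁ - o₂) - (i₁ - i₂)) ≡ y - ((o₁ - i₁) - (o₂ - i₂))
    regroup = solve-∀ ℚ-ring

module ActCoordinate (n : ℕ) (a : Fin (n ∸ 1) → ℕ) (P : Permutation′ n) {c : ℕ} (1≤c : 1 ≤ c) (c<n : c < n) where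
  open OneBased n
  open Tail n a

  private
    σc = ⟪ P ⟫ c
    σc′ = ⟪ P ⟫ (suc c)
    σc-range = ⟪⟫-range P c 1≤c (ℕ.<⇒≤ c<n)
    σc′-range = ⟪⟫-range P (suc c) (s≤s z≤n) c<n

  flip-hits : ∀ {k v} → 1 ≤ k → k ≤ n → 1 ≤ v → v ≤ n → (permℕ (flip P) k ≡ᵇ v) ≡ (k ≡ᵇ ⟪ P ⟫ v)
  flip-hits {k} {v} 1≤k k≤n 1≤v v≤n =
    does-⇔ (subst (λ m → (m ≡ v) ⇔ (k ≡ ⟪ P ⟫ v)) (sym (permℕ≡⟪⟫ (flip P) 1≤k k≤n)) (⟪flip⟫ P 1≤k k≤n 1≤v v≤n))
      (permℕ (flip P) k ≟ v) (k ≟ ⟪ P ⟫ v)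

  column : ∀ i → i < n →
    sumℚ 1 (suc i) (λ k → ε n (permℕ (flip P) k) c) ≡ 𝟙 (σc <ᵇ suc i) - 𝟙 (σc′ <ᵇ suc i)
  column i i<n = begin
    sumℚ 1 (suc i) (λ k → ε n (permℕ (flip P) k) c)                          ≡⟨ sum-cong 1 (suc i) term ⟩
    sumℚ 1 (suc i) (λ k → 𝟙 (k ≡ᵇ σc) - 𝟙 (k ≡ᵇ σc′))                        ≡⟨ sum-sub 1 (suc i) _ _ ⟩
    sumℚ 1 (suc i) (λ k → 𝟙 (k ≡ᵇ σc)) - sumℚ 1 (suc i) (λ k → 𝟙 (k ≡ᵇ σc′)) ≡⟨ cong₂ _-_ (count-𝟙 i (proj₁ σc-range)) (count-𝟙 i (proj₁ σc′-range)) ⟩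
    𝟙 (σc <ᵇ suc i) - 𝟙 (σc′ <ᵇ suc i)                                       ∎
    where
    open ≡-Reasoning
    open Coordinates n 1≤c c<n using (ε-coord)
    term : ∀ k → 1 ≤ k → k < suc i → ε n (permℕ (flip P) k) c ≡ 𝟙 (k ≡ᵇ σc) - 𝟙 (k ≡ᵇ σc′)
    term k 1≤k k≤i = trans (ε-coord _ (subst (1 ≤_) (sym (permℕ≡⟪⟫ (flip P) 1≤k k≤n)) (proj₁ (⟪⟫-range (flip P) k 1≤k k≤n))))
      (cong₂ (λ u v → 𝟙 u - 𝟙 v) (flip-hits 1≤k k≤n 1≤c (ℕ.<⇒≤ c<n)) (flip-hits 1≤k k≤n (s≤s z≤n) c<n))
      where k≤n = ℕ.≤-trans (ℕ.≤-pred k≤i) (ℕ.<⇒≤ i<n)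

  act-coord : act n (flip P) (λw n a) c ≡ Λ σc - Λ σc′
  act-coord = begin
    sumℚ 1 n (λ i → λw n a i * sumℚ 1 (suc i) (λ k → ε n (permℕ (flip P) k) c))
      ≡⟨ sum-cong 1 n term ⟩
    sumℚ 1 n (λ i → aᵢ i * 𝟙 (σc <ᵇ suc i) - aᵢ i * 𝟙 (σc′ <ᵇ suc i))
      ≡⟨ sum-sub 1 n _ _ ⟩
    sumℚ 1 n (λ i → aᵢ i * 𝟙 (σc <ᵇ suc i)) - sumℚ 1 n (λ i → aᵢ i * 𝟙 (σc′ <ᵇ suc i))
      ≡⟨ cong₂ _-_ (Λ-as-sum (proj₁ σc-range) (proj₂ σc-range)) (Λ-as-sum (proj₁ σc′-range) (proj₂ σc′-range)) ⟩
    Λ σc - Λ σc′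
      ∎
    where
    open ≡-Reasoning
    distribute : ∀ y u v → y * (u - v) ≡ y * u - y * v
    distribute = solve-∀ ℚ-ring
    term : ∀ i → 1 ≤ i → i < n → λw n a i * sumℚ 1 (suc i) (λ k → ε n (permℕ (flip P) k) c) ≡
      aᵢ i * 𝟙 (σc <ᵇ suc i) - aᵢ i * 𝟙 (σc′ <ᵇ suc i)
    term i 1≤i i<n = trans (cong₂ _*_ (Coordinates.λ-coord n 1≤i i<n a) (column i i<n)) (distribute (aᵢ i) _ _)

-- Flows along the sweep

module Flow (n : ℕ) (a : Fin (n ∸ 1) → ℕ) (E : SegSet) (rp : IsRp n E) where
  open Sweep n
  open Tail n a

  module _ (x : Point) (x-off : ∀ i j → InRange n i j → E i j ≡ false → x i j ≡ 0ℚ) where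

    xₚ : ℕ → ℕ → ℕ → ℕ → ℚ
    xₚ j c a b with processed? j c a b
    ... | yes _ = x a b
    ... | no _  = 0ℚ

    xₚ-processed : ∀ {j c a b} → Processed j c a b → xₚ j c a b ≡ x a b
    xₚ-processed {j} {c} {a} {b} done with processed? j c a b
    ... | yes _ = refl
    ... | no ¬done = ⊥-elim (¬done done)

    xₚ-unprocessed : ∀ {j c a b} → ¬ Processed j c a b → xₚ j c a b ≡ 0ℚ
    xₚ-unprocessed {j} {c} {a} {b} ¬done with processed? j c a b
    ... | yes done = ⊥-elim (¬done done)
    ... | no _     = refl

    xₚ-zero : ∀ {j c a b} → x a b ≡ 0ℚ → xₚ j c a b ≡ 0ℚ
    xₚ-zero {j} {c} {a} {b} x≡0 with processed? j c a b
    ... | yes _ = x≡0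
    ... | no _  = refl

    outflow inflow net : ℕ → ℕ → ℕ → ℚ
    outflow j c m = sumℚ (suc m) (suc n) (xₚ j c m)
    inflow  j c m = sumℚ 1 m (λ a → xₚ j c a m)
    net     j c m = outflow j c m - inflow j c m

    FlowInvariant : ℕ → ℕ → Set
    FlowInvariant j c = ∀ m → 1 ≤ m → m ≤ n → net j c m ≡ Λ m - Λ (σ E j c m)

    flow-initial : FlowInvariant 0 0
    flow-initial m 1≤m _ = begin
      outflow 0 0 m - inflow 0 0 m  ≡⟨ cong₂ _-_ no-outflow no-inflow ⟩
      0ℚ - 0ℚ                       ≡⟨ ℚ.+-inverseʳ 0ℚ ⟩
      0ℚ                            ≡⟨ ℚ.+-inverseʳ (Λ m) ⟨
      Λ m - Λ m                     ≡⟨ cong (λ m′ → Λ m - Λ m′) (⟪⟫-id m) ⟨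
      Λ m - Λ (σ E 0 0 m)           ∎
      where
      open ≡-Reasoning
      no-outflow = sum-zero (suc m) (suc n) λ b m<b _ → xₚ-unprocessed (unprocessed-initial 1≤m m<b)
      no-inflow  = sum-zero 1 m λ a 1≤a a<m → xₚ-unprocessed (unprocessed-initial 1≤a a<m)

    xₚ-next-column : ∀ {j a b} → 1 ≤ a → a < b → xₚ (suc j) 0 a b ≡ xₚ j j a b
    xₚ-next-column {j} {a} {b} 1≤a a<b with processed? j j a b
    ... | yes done = xₚ-processed (proj₂ (processed-next-column 1≤a a<b) done)
    ... | no ¬done = xₚ-unprocessed (λ done → ¬done (proj₁ (processed-next-column 1≤a a<b) done))

    flow-next-column : ∀ {j} → FlowInvariant j j → FlowInvariant (suc j) 0
    flow-next-column ih m 1≤m m≤n = trans (cong₂ _-_ same-outflow same-inflow) (ih m 1≤m m≤n)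
      where
      same-outflow = sum-cong (suc m) (suc n) λ b m<b _ → xₚ-next-column 1≤m m<b
      same-inflow  = sum-cong 1 m λ a 1≤a a<m → xₚ-next-column 1≤a a<m

    module _ {j c} (c<j : c < j) (1+j≤n : suc j ≤ n) where
      private
        k = j ∸ c
        l = suc j
        1≤k : 1 ≤ k
        1≤k = 1≤j∸c c<j
        k<l : k < l
        k<l = j∸c<1+j j c
        kl-range : InRange n k l
        kl-range = 1≤k , k<l , 1+j≤n

      xₚ-other : ∀ a b → a ≢ k ⊎ b ≢ l → xₚ j (suc c) a b ≡ xₚ j c a b
      xₚ-other a b not-current with processed? j c a b
      ... | yes done = xₚ-processed (processed-suc⁺ c<j done)
      ... | no ¬done = xₚ-unprocessed λ done′ → impossible (processed-suc⁻ c<j done′) not-current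
        where
        impossible : Processed j c a b ⊎ (a ≡ k × b ≡ l) → a ≢ k ⊎ b ≢ l → ⊥
        impossible (inj₁ done)        _            = ¬done done
        impossible (inj₂ (a≡k , _))   (inj₁ a≢k)   = a≢k a≡k
        impossible (inj₂ (_ , b≡l))   (inj₂ b≢l)   = b≢l b≡l

      xₚ-current : xₚ j (suc c) k l - xₚ j c k l ≡ x k l
      xₚ-current = begin
        xₚ j (suc c) k l - xₚ j c k l ≡⟨ cong₂ _-_ (xₚ-processed (processed-current c<j)) (xₚ-unprocessed (unprocessed-current j c)) ⟩
        x k l - 0ℚ                    ≡⟨ ℚ.+-identityʳ (x k l) ⟩
        x k l                         ∎
        where open ≡-Reasoning

      xₚ-unchanged : x k l ≡ 0ℚ → ∀ a b → xₚ j (suc c) a b ≡ xₚ j c a b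
      xₚ-unchanged x≡0 a b = by-cases (a ≟ k) (b ≟ l)
        where
        by-cases : Dec (a ≡ k) → Dec (b ≡ l) → xₚ j (suc c) a b ≡ xₚ j c a b
        by-cases (no a≢k)   _          = xₚ-other a b (inj₁ a≢k)
        by-cases _          (no b≢l)   = xₚ-other a b (inj₂ b≢l)
        by-cases (yes refl) (yes refl) = trans (xₚ-zero {j} {suc c} x≡0) (sym (xₚ-zero {j} {c} x≡0))

      net-unchanged : x k l ≡ 0ℚ → ∀ m → net j (suc c) m ≡ net j c m
      net-unchanged x≡0 m = cong₂ _-_
        (sum-cong (suc m) (suc n) λ b _ _ → xₚ-unchanged x≡0 m b)
        (sum-cong 1 m λ a _ _ → xₚ-unchanged x≡0 a m)

      net-k : net j (suc c) k ≡ net j c k + x k l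
      net-k = begin
        outflow j (suc c) k - inflow j (suc c) k
          ≡⟨ cong₂ _-_ outflow-k inflow-k ⟩
        (outflow j c k + (xₚ j (suc c) k l - xₚ j c k l)) - inflow j c k
          ≡⟨ cong (λ y → (outflow j c k + y) - inflow j c k) xₚ-current ⟩
        (outflow j c k + x k l) - inflow j c k
          ≡⟨ rearrange (outflow j c k) (inflow j c k) (x k l) ⟩
        net j c k + x k l
          ∎
        where
        open ≡-Reasoning
        outflow-k = sum-update (suc k) (suc n) (xₚ j c k) (xₚ j (suc c) k) l k<l (s≤s 1+j≤n)
          (λ b b≢l → sym (xₚ-other k b (inj₂ b≢l)))
        inflow-k = sum-cong 1 k λ a _ a<k → xₚ-other a k (inj₁ (ℕ.<⇒≢ a<k))
        rearrange : ∀ o i y → (o + y) - i ≡ (o - i) + y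
        rearrange = solve-∀ ℚ-ring

      net-l : net j (suc c) l ≡ net j c l - x k l
      net-l = begin
        outflow j (suc c) l - inflow j (suc c) l
          ≡⟨ cong₂ _-_ outflow-l inflow-l ⟩
        outflow j c l - (inflow j c l + (xₚ j (suc c) k l - xₚ j c k l))
          ≡⟨ cong (λ y → outflow j c l - (inflow j c l + y)) xₚ-current ⟩
        outflow j c l - (inflow j c l + x k l)
          ≡⟨ rearrange (outflow j c l) (inflow j c l) (x k l) ⟩
        net j c l - x k l
          ∎
        where
        open ≡-Reasoning
        outflow-l = sum-cong (suc l) (suc n) λ b l<b _ → xₚ-other l b (inj₂ (ℕ.>⇒≢ l<b))
        inflow-l = sum-update 1 l (λ a → xₚ j c a l) (λ a → xₚ j (suc c) a l) k 1≤k k<l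
          (λ a a≢k → sym (xₚ-other a l (inj₁ a≢k)))
        rearrange : ∀ o i y → o - (i + y) ≡ (o - i) - y
        rearrange = solve-∀ ℚ-ring

      net-other : ∀ m → m ≢ k → m ≢ l → net j (suc c) m ≡ net j c m
      net-other m m≢k m≢l = cong₂ _-_
        (sum-cong (suc m) (suc n) λ b _ _ → xₚ-other m b (inj₁ m≢k))
        (sum-cong 1 m λ a _ _ → xₚ-other a m (inj₂ m≢l))

      flow-next-segment : FlowInvariant j c →
        (E k l ≡ true → x k l ≡ Λ (σ E j c k) - Λ (σ E j c l)) → FlowInvariant j (suc c)
      flow-next-segment ih x-value with E k l in kl∈E
      ... | false = λ m 1≤m m≤n → begin
        net j (suc c) m            ≡⟨ net-unchanged (x-off k l kl-range kl∈E) m ⟩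
        net j c m                  ≡⟨ ih m 1≤m m≤n ⟩
        Λ m - Λ (σ E j c m)        ≡⟨ cong (λ m′ → Λ m - Λ m′) (σ-∉ E {j} {c} kl∈E m) ⟨
        Λ m - Λ (σ E j (suc c) m)  ∎
        where open ≡-Reasoning
      ... | true = λ m 1≤m m≤n →
        trans (by-position m 1≤m m≤n (position k l m))
              (cong (λ m′ → Λ m - Λ m′) (sym (σ-∈ E {j} {c} c<j 1+j≤n kl∈E m)))
        where
        open ≡-Reasoning
        telescope : ∀ u v w → (u - v) + (v - w) ≡ u - w
        telescope = solve-∀ ℚ-ring
        telescope′ : ∀ u v w → (u - v) - (w - v) ≡ u - w
        telescope′ = solve-∀ ℚ-ring
        by-position : ∀ m → 1 ≤ m → m ≤ n → Position k l m → net j (suc c) m ≡ Λ m - Λ (σ E j c (swap k l m))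
        by-position m 1≤m m≤n (at-k refl) = begin
          net j (suc c) k                                       ≡⟨ net-k ⟩
          net j c k + x k l                                     ≡⟨ cong₂ _+_ (ih k 1≤m m≤n) (x-value refl) ⟩
          (Λ k - Λ (σ E j c k)) + (Λ (σ E j c k) - Λ (σ E j c l)) ≡⟨ telescope (Λ k) _ _ ⟩
          Λ k - Λ (σ E j c l)                                   ≡⟨ cong (λ m′ → Λ k - Λ (σ E j c m′)) (swap-k k l) ⟨
          Λ k - Λ (σ E j c (swap k l k))                        ∎
        by-position m 1≤m m≤n (at-l refl) = begin
          net j (suc c) l                                       ≡⟨ net-l ⟩
          net j c l - x k l                                     ≡⟨ cong₂ _-_ (ih l 1≤m m≤n) (x-value refl) ⟩
          (Λ l - Λ (σ E j c l)) - (Λ (σ E j c k) - Λ (σ E j c l)) ≡⟨ telescope′ (Λ l) _ _ ⟩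
          Λ l - Λ (σ E j c k)                                   ≡⟨ cong (λ m′ → Λ l - Λ (σ E j c m′)) (swap-l k l (ℕ.<⇒≢ k<l)) ⟨
          Λ l - Λ (σ E j c (swap k l l))                        ∎
        by-position m 1≤m m≤n (elsewhere m≢k m≢l) = begin
          net j (suc c) m                  ≡⟨ net-other m m≢k m≢l ⟩
          net j c m                        ≡⟨ ih m 1≤m m≤n ⟩
          Λ m - Λ (σ E j c m)              ≡⟨ cong (λ m′ → Λ m - Λ (σ E j c m′)) (swap-other k l m m≢k m≢l) ⟨
          Λ m - Λ (σ E j c (swap k l m))   ∎

      no-inflow-k : E k l ≡ true → inflow j c k ≡ 0ℚ
      no-inflow-k kl∈E = sum-zero 1 k λ a 1≤a a<k → xₚ-zero (x-off a k (1≤a , a<k , k≤n) (∉E a 1≤a a<k))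
        where
        k≤n = ℕ.≤-trans (ℕ.<⇒≤ k<l) 1+j≤n
        ∉E : ∀ a → 1 ≤ a → a < k → E a k ≡ false
        ∉E a 1≤a a<k with E a k in ak∈E
        ... | false = refl
        ... | true  = ⊥-elim (rp-no-abutting rp (1≤a , a<k , k≤n) kl-range ak∈E kl∈E)

      outflow-k : outflow j c k ≡ sumℚ (suc k) l (x k)
      outflow-k = begin
        outflow j c k                                            ≡⟨ sum-split (suc k) l (suc n) _ k<l (ℕ.m≤n⇒m≤1+n 1+j≤n) ⟩
        sumℚ (suc k) l (xₚ j c k) + sumℚ l (suc n) (xₚ j c k)    ≡⟨ cong₂ _+_ processed-part unprocessed-part ⟩
        sumℚ (suc k) l (x k) + 0ℚ                                ≡⟨ ℚ.+-identityʳ _ ⟩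
        sumℚ (suc k) l (x k)                                     ∎
        where
        open ≡-Reasoning
        processed-part = sum-cong (suc k) l λ b _ b<l → xₚ-processed (earlier-column (ℕ.≤-pred b<l))
        unprocessed-part = sum-zero l (suc n) λ b l≤b _ → xₚ-unprocessed {j} {c} λ where
          (earlier-column b≤j)   → ℕ.<⇒≱ l≤b b≤j
          (this-column _ k<k)    → ℕ.<-irrefl refl k<k

      no-outflow-l : outflow j c l ≡ 0ℚ
      no-outflow-l = sum-zero (suc l) (suc n) λ b l<b _ → xₚ-unprocessed {j} {c} λ where
        (earlier-column b≤j)   → ℕ.<⇒≱ (ℕ.<-trans (ℕ.n<1+n j) l<b) b≤j
        (this-column b≡l _)    → ℕ.>⇒≢ l<b b≡l

      inflow-l : inflow j c l ≡ sumℚ (suc k) l (λ a → x a l)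
      inflow-l = begin
        inflow j c l                                                      ≡⟨ sum-split 1 (suc k) l _ (s≤s z≤n) k<l ⟩
        sumℚ 1 (suc k) (λ a → xₚ j c a l) + sumℚ (suc k) l (λ a → xₚ j c a l) ≡⟨ cong₂ _+_ unprocessed-part processed-part ⟩
        0ℚ + sumℚ (suc k) l (λ a → x a l)                                 ≡⟨ ℚ.+-identityˡ _ ⟩
        sumℚ (suc k) l (λ a → x a l)                                      ∎
        where
        open ≡-Reasoning
        processed-part = sum-cong (suc k) l λ a k<a _ → xₚ-processed (this-column refl k<a)
        unprocessed-part = sum-zero 1 (suc k) λ a _ a≤k → xₚ-unprocessed {j} {c} λ where
          (earlier-column l≤j)  → ℕ.<-irrefl refl l≤j
          (this-column _ k<a)   → ℕ.<⇒≱ k<a (ℕ.≤-pred a≤k)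

      S-as-net : E k l ≡ true → S x k l ≡ (x k l + net j c k) - net j c l
      S-as-net kl∈E = begin
        S x k l
          ≡⟨ cong₂ _+_ (sum-snoc (suc k) l (x k) k<l) (sym inflow-l) ⟩
        (sumℚ (suc k) l (x k) + x k l) + inflow j c l
          ≡⟨ cong (λ o → (o + x k l) + inflow j c l) outflow-k ⟨
        (outflow j c k + x k l) + inflow j c l
          ≡⟨ rearrange (outflow j c k) (x k l) (inflow j c l) ⟩
        (x k l + (outflow j c k - 0ℚ)) - (0ℚ - inflow j c l)
          ≡⟨ cong₂ (λ i o → (x k l + (outflow j c k - i)) - (o - inflow j c l)) (no-inflow-k kl∈E) no-outflow-l ⟨
        (x k l + net j c k) - net j c l
          ∎
        where
        open ≡-Reasoning
        rearrange : ∀ o y i → (o + y) + i ≡ (y + (o - 0ℚ)) - (0ℚ - i)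
        rearrange = solve-∀ ℚ-ring

      module _ (flow : FlowInvariant j c) (kl∈E : E k l ≡ true) where
        private
          Λσk = Λ (σ E j c k)
          Λσl = Λ (σ E j c l)
          flow-k : net j c k ≡ Λ k - Λσk
          flow-k = flow k 1≤k (ℕ.≤-trans (ℕ.<⇒≤ k<l) 1+j≤n)
          flow-l : net j c l ≡ Λ l - Λσl
          flow-l = flow l (ℕ.≤-trans 1≤k (ℕ.<⇒≤ k<l)) 1+j≤n

        x-value-from-S : S x k l ≡ sumA n a k l → x k l ≡ Λσk - Λσl
        x-value-from-S S≡ = begin
          x k l                                                 ≡⟨ solve-x (x k l) (net j c k) (net j c l) ⟩
          (((x k l + net j c k) - net j c l) - net j c k) + net j c l ≡⟨ cong (λ s → (s - net j c k) + net j c l) S≡Λk-Λl ⟩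
          ((Λ k - Λ l) - net j c k) + net j c l                 ≡⟨ cong₂ (λ u v → ((Λ k - Λ l) - u) + v) flow-k flow-l ⟩
          ((Λ k - Λ l) - (Λ k - Λσk)) + (Λ l - Λσl)             ≡⟨ collapse (Λ k) (Λ l) Λσk Λσl ⟩
          Λσk - Λσl                                             ∎
          where
          open ≡-Reasoning
          S≡Λk-Λl = trans (sym (S-as-net kl∈E)) (trans S≡ (sumA≡Λ-Λ (ℕ.<⇒≤ k<l) 1+j≤n))
          solve-x : ∀ y u v → y ≡ (((y + u) - v) - u) + v
          solve-x = solve-∀ ℚ-ring
          collapse : ∀ u v w z → ((u - v) - (u - w)) + (v - z) ≡ w - z
          collapse = solve-∀ ℚ-ring

        S-from-x-value : x k l ≡ Λσk - Λσl → S x k l ≡ sumA n a k l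
        S-from-x-value x≡ = begin
          S x k l                                        ≡⟨ S-as-net kl∈E ⟩
          (x k l + net j c k) - net j c l                ≡⟨ cong₂ _-_ (cong₂ _+_ x≡ flow-k) flow-l ⟩
          ((Λσk - Λσl) + (Λ k - Λσk)) - (Λ l - Λσl)      ≡⟨ collapse (Λ k) (Λ l) Λσk Λσl ⟩
          Λ k - Λ l                                      ≡⟨ sumA≡Λ-Λ (ℕ.<⇒≤ k<l) 1+j≤n ⟨
          sumA n a k l                                   ∎
          where
          open ≡-Reasoning
          collapse : ∀ u v w z → ((w - z) + (u - w)) - (v - z) ≡ u - v
          collapse = solve-∀ ℚ-ring

    XRecurrence : Set
    XRecurrence = ∀ {j c} → c < j → suc j ≤ n → FlowInvariant j c → E (j ∸ c) (suc j) ≡ true →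
      x (j ∸ c) (suc j) ≡ Λ (σ E j c (j ∸ c)) - Λ (σ E j c (suc j))

    flow-invariant : XRecurrence → ∀ {j c} → c ≤ j → suc j ≤ n → FlowInvariant j c
    flow-invariant recurrence = state-induction FlowInvariant flow-initial
      (λ c<j 1+j≤n ih → flow-next-segment c<j 1+j≤n ih (recurrence c<j 1+j≤n ih))
      (λ _ → flow-next-column)

    recurrence-from-IsXE : IsXE n a E x → XRecurrence
    recurrence-from-IsXE xe {j} {c} c<j 1+j≤n flow kl∈E =
      x-value-from-S c<j 1+j≤n flow kl∈E (proj₂ (xe (j ∸ c) (suc j) (1≤j∸c c<j , j∸c<1+j j c , 1+j≤n)) kl∈E)

    net-final : ∀ {j} → n ≡ suc j → ∀ m → 1 ≤ m → m ≤ n → net j j m ≡ divergence n x m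
    net-final refl m 1≤m m≤n = cong₂ _-_
      (sum-cong (suc m) (suc n) λ b m<b b≤n → xₚ-processed (processed-final 1≤m m<b (ℕ.≤-pred b≤n)))
      (sum-cong 1 m λ a 1≤a a<m → xₚ-processed (processed-final 1≤a a<m m≤n))

  -- The value forced on [i,j] by the recurrence, read off in the state just before [i,j] is processed.
  x[E] : Point
  x[E] i j = if E i j then Λ (σ E (j ∸ 1) (j ∸ 1 ∸ i) i) - Λ (σ E (j ∸ 1) (j ∸ 1 ∸ i) j) else 0ℚ

  x[E]-off : ∀ i j → InRange n i j → E i j ≡ false → x[E] i j ≡ 0ℚ
  x[E]-off i j _ ij∉E rewrite ij∉E = refl

  x[E]-recurrence : XRecurrence x[E] x[E]-off
  x[E]-recurrence {j} {c} c<j _ _ kl∈E rewrite kl∈E | ℕ.m∸[m∸n]≡n (ℕ.<⇒≤ c<j) = refl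

  x[E]-IsXE : IsXE n a E x[E]
  x[E]-IsXE i j r = x[E]-off i j r , S-value i j r
    where
    S-value : ∀ i j → InRange n i j → E i j ≡ true → S x[E] i j ≡ sumA n a i j
    S-value i (suc j) (1≤i , s≤s i≤j , 1+j≤n) ij∈E =
      subst (λ k → S x[E] k (suc j) ≡ sumA n a k (suc j)) j∸c≡i
        (S-from-x-value x[E] x[E]-off c<j 1+j≤n flow kl∈E (x[E]-recurrence c<j 1+j≤n flow kl∈E))
      where
      c = j ∸ i
      c<j : c < j
      c<j = ℕ.∸-monoʳ-< {o = 0} 1≤i i≤j
      j∸c≡i : j ∸ c ≡ i
      j∸c≡i = ℕ.m∸[m∸n]≡n i≤j
      kl∈E : E (j ∸ c) (suc j) ≡ true
      kl∈E = subst (λ k → E k (suc j) ≡ true) (sym j∸c≡i) ij∈E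
      flow : FlowInvariant x[E] x[E]-off j c
      flow = flow-invariant x[E] x[E]-off x[E]-recurrence (ℕ.<⇒≤ c<j) 1+j≤n

-- The map Ψ

module Ψ-construction (j : ℕ) where
  open Sweep (suc j)

  Ψ : SegSet → Permutation′ (suc j)
  Ψ E = flip (sweep E (suc j))

  Ψ-injective : ∀ E E′ → IsRp (suc j) E → IsRp (suc j) E′ → (Ψ E ≈p Ψ E′) ⇔ SameSet (suc j) E E′
  Ψ-injective E E′ rp rp′ = mk⇔
    (λ Ψ≈Ψ′ i k r@(1≤i , i<k , k≤n) →
      σ-determines-processed rp rp′ ℕ.≤-refl ℕ.≤-refl (⟪⟫-cong (flip-cong {Ψ E} {Ψ E′} Ψ≈Ψ′)) r
        (processed-final 1≤i i<k k≤n))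
    (λ same → flip-cong {sweep E (suc j)} {sweep E′ (suc j)} (sweep-cong same (suc j)))

  μ≈Ψλ : ∀ a E → IsRp (suc j) E → ∀ x → IsXE (suc j) a E x →
    μ (suc j) a x ≈w[ suc j ] act (suc j) (Ψ E) (λw (suc j) a)
  μ≈Ψλ a E rp x xe c 1≤c c<n = begin
    μ n a x c
      ≡⟨ MuCoordinate.μ-coord n a x {c} 1≤c c<n ⟩
    aᵢ c - (divergence n x c - divergence n x (suc c))
      ≡⟨ cong₂ (λ u v → aᵢ c - (u - v)) (flow-at c 1≤c (ℕ.<⇒≤ c<n)) (flow-at (suc c) (s≤s z≤n) c<n) ⟩
    aᵢ c - ((Λ c - Λ (σₙ c)) - (Λ (suc c) - Λ (σₙ (suc c))))
      ≡⟨ cong (_- ((Λ c - Λ (σₙ c)) - (Λ (suc c) - Λ (σₙ (suc c))))) (aᵢ≡Λ-Λ c<n) ⟩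
    (Λ c - Λ (suc c)) - ((Λ c - Λ (σₙ c)) - (Λ (suc c) - Λ (σₙ (suc c))))
      ≡⟨ cancel (Λ c) (Λ (suc c)) (Λ (σₙ c)) (Λ (σₙ (suc c))) ⟩
    Λ (σₙ c) - Λ (σₙ (suc c))
      ≡⟨ ActCoordinate.act-coord n a (sweep E n) {c} 1≤c c<n ⟨
    act n (Ψ E) (λw n a) c
      ∎
    where
    open ≡-Reasoning
    open Tail (suc j) a
    open Flow (suc j) a E rp
    n = suc j
    σₙ = σ E j j
    x-off = λ i k r → proj₁ (xe i k r)
    flow-at : ∀ m → 1 ≤ m → m ≤ n → divergence n x m ≡ Λ m - Λ (σₙ m)
    flow-at m 1≤m m≤n = trans (sym (net-final x x-off refl m 1≤m m≤n))
      (flow-invariant x x-off (recurrence-from-IsXE x x-off xe) ℕ.≤-refl ℕ.≤-refl m 1≤m m≤n)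
    cancel : ∀ u v w z → (u - v) - ((u - w) - (v - z)) ≡ w - z
    cancel = solve-∀ ℚ-ring

lemma3p3 : (n : ℕ) → 2 ≤ n → (a : Fin (n ∸ 1) → ℕ) →
    Σ[ Ψ ∈ (SegSet → Permutation′ n) ]
      ((∀ E E′ → IsRp n E → IsRp n E′ → ((Ψ E ≈p Ψ E′) ⇔ SameSet n E E′))
      × (∀ E → IsRp n E →
           (∃ λ x → IsXE n a E x)
           × (∀ x → IsXE n a E x → μ n a x ≈w[ n ] act n (Ψ E) (λw n a))))
lemma3p3 (suc j) _ a = Ψ , Ψ-injective , λ E rp →
  (Flow.x[E] (suc j) a E rp , Flow.x[E]-IsXE (suc j) a E rp) , μ≈Ψλ a E rp
  where open Ψ-construction j
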